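{- Let $h\geq 1$ and let $\vec c=[c_1,\ldots,c_h]$ be a color sequence of dimension $h$, i.e. integers $1\leq c_1\leq c_2\leq\cdots\leq c_h$. Then the perfect binary tree $T(h)$ admits an ancestral $\vec c$-coloring if and only if $\vec c$ is $h$-feasible, i.e. if and only if (C1) $\sum_{i=1}^{\ell} c_i\geq \sum_{i=1}^{\ell}2^i$ for every $1\leq \ell\leq h$, and (C2) $\sum_{i=1}^{h} c_i = \sum_{i=1}^{h}2^i = 2^{h+1}-2$.
   Context: $T(h)$ denotes the perfect binary tree of height $h$: its nodes are $1,2,\ldots,2^{h+1}-1$, node $1$ is the root, and the children of node $R$ (for $R<2^h$) are $2R$ and $2R+1$; it has $2^h$ leaves and Layer $i$ (nodes at depth $i$) has $2^i$ nodes. An ancestral $\vec c$-coloring of $T(h)$ is an assignment of a color from $\{1,\ldots,h\}$ to every node except the root (the root is colorless) such that exactly $c_i$ nodes receive color $i$ for each $i$, and no two nodes $u,v$ such that $u$ is an ancestor of $v$ receive the same color. -}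

module Defs where

open import Data.Nat using (ℕ; zero; suc; _+_; _*_; _^_; _≤_; _<_; _/_)
open import Data.Nat.Properties using (_≟_)
open import Data.List using (List; []; _∷_; length; filter; map; sum; upTo)
open import Data.Product using (Σ; _×_; _,_; ∃-syntax)
open import Relation.Binary.PropositionalEquality using (_≡_; _≢_)

-- Nodes of T(h): 1 .. 2^(h+1) - 1, node 1 is the root.
-- Non-root nodes of T(h): 2 .. 2^(h+1) - 1, listed explicitly.
-- rangeFrom a k = [a, a+1, ..., a+k-1]
rangeFrom : ℕ → ℕ → List ℕ
rangeFrom a zero = []
rangeFrom a (suc k) = a ∷ rangeFrom (suc a) k

nonRootNodes : ℕ → List ℕ
nonRootNodes h = rangeFrom 2 (2 ^ suc h Data.Nat.∸ 2)

IsNonRootNode : ℕ → ℕ → Set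
IsNonRootNode h v = 2 ≤ v × v < 2 ^ suc h

-- u is a (proper) ancestor of v: u = parent^k(v) for some k ≥ 1, parent R = ⌊R/2⌋
-- (parent of R is ⌊R/2⌋ since the children of R are 2R and 2R+1)
parentIter : ℕ → ℕ → ℕ
parentIter zero v = v
parentIter (suc k) v = parentIter k v / 2

IsAncestor : ℕ → ℕ → Set
IsAncestor u v = ∃[ k ] (1 ≤ k × parentIter k v ≡ u)

colorCount : ℕ → (ℕ → ℕ) → ℕ → ℕ
colorCount h col i = length (filter (λ v → col v ≟ i) (nonRootNodes h))

-- Ancestral c-coloring of T(h): col assigns to each non-root node a color
-- in {1..h}; exactly c i nodes get color i (1 ≤ i ≤ h); no ancestor/descendant
-- pair of non-root nodes shares a color. (Values of col at other naturals,
-- e.g. the root, are irrelevant.)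
IsAncestralColoring : (h : ℕ) → (c : ℕ → ℕ) → (ℕ → ℕ) → Set
IsAncestralColoring h c col =
  ((v : ℕ) → IsNonRootNode h v → 1 ≤ col v × col v ≤ h)
  × ((i : ℕ) → 1 ≤ i → i ≤ h → colorCount h col i ≡ c i)
  × ((u v : ℕ) → IsNonRootNode h u → IsNonRootNode h v →
       IsAncestor u v → col u ≢ col v)

HasAncestralColoring : (h : ℕ) → (ℕ → ℕ) → Set
HasAncestralColoring h c = ∃[ col ] IsAncestralColoring h c col

sumTo : ℕ → (ℕ → ℕ) → ℕ
sumTo zero f = 0
sumTo (suc ℓ) f = sumTo ℓ f + f (suc ℓ)

IsColorSequence : ℕ → (ℕ → ℕ) → Set
IsColorSequence h c =
  ((i : ℕ) → 1 ≤ i → i ≤ h → 1 ≤ c i)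
  × ((i : ℕ) → 1 ≤ i → i < h → c i ≤ c (suc i))

IsFeasible : ℕ → (ℕ → ℕ) → Set
IsFeasible h c =
  ((ℓ : ℕ) → 1 ≤ ℓ → ℓ ≤ h → sumTo ℓ (2 ^_) ≤ sumTo ℓ c)
  × (sumTo h c ≡ sumTo h (2 ^_))

-- Necessity: the h non-root nodes on a root-to-leaf path carry h distinct colours, so at most h − ℓ
-- of them have a colour above ℓ.  Hence, counting subtree by subtree while remembering the ancestor
-- colours, at least 2 + 4 + ⋯ + 2^ℓ nodes have a colour at most ℓ, which is (C1); (C2) counts all nodes.
--
-- Sufficiency, by induction on h.  Instead of (C1) the induction carries the condition that for every
-- threshold s the deficit Σᵢ (s ∸ cᵢ) is at most Σⱼ (s ∸ 2ʲ): it ignores the order of the quotas and,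
-- for a sorted sequence, is equivalent to (C1).  Let c₁ ≤ c₂ ≤ c₃ ≤ ⋯ be the quotas of colours κ₁, κ₂,
-- κ₃, ….  If c₁ = 2, both children of the root get κ₁ and every other quota is halved between the two
-- subtrees, rounding so that every prefix sum is halved too.  If c₁ ≥ 3, the children get κ₁ and κ₂,
-- the left subtree receives c₂ − 1 nodes of colour κ₂, the right one c₁ − 1 nodes of colour κ₁, κ₃ is
-- shared so that both subtrees get 2^h − 2 nodes, and the other quotas are halved.  Elementary
-- estimates, using (C1) for the first p + 3 quotas, show that both halves satisfy the deficit
-- condition again.  Trees are then matched with the heap numbering v ↦ 2v, 2v + 1 of T(h).

module Submission where

open import Defs
open import Data.Nat using (ℕ; _≤_)
open import Function.Bundles using (_⇔_; mk⇔)

open import Data.Nat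
open import Data.Nat.Properties
open import Data.Nat.DivMod using (m/n≡1+[m∸n]/n)
open import Data.Nat.ListAction using (sum)
open import Data.Nat.ListAction.Properties using (sum-↭; sum-++)
open import Data.Nat.Tactic.RingSolver using (solve-∀)
open import Data.List.Base using (List; []; _∷_; length; map; take; drop; filter; [_]; _∷ʳ_; _++_)
import Data.List.Properties as List
open import Data.List.Relation.Unary.All using (All; []; _∷_)
import Data.List.Relation.Unary.All as All
open import Data.List.Relation.Unary.All.Properties using (All¬⇒¬Any; ¬Any⇒All¬; all-filter; filter⁺)
open import Data.List.Relation.Unary.AllPairs using (AllPairs; []; _∷_)
import Data.List.Relation.Unary.AllPairs as AllPairs
open import Data.List.Relation.Unary.Linked using (Linked; []; [-]; _∷_)
open import Data.List.Relation.Unary.Linked.Properties using (Linked⇒AllPairs)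
open import Data.List.Relation.Unary.Any using (here; there)
open import Data.List.Relation.Unary.Unique.Propositional using (Unique)
import Data.List.Relation.Unary.Unique.Propositional.Properties as Unique
open import Data.List.Membership.Propositional using (_∈_; _∉_)
open import Data.List.Membership.Propositional.Properties using (∈-++⁻; ∈-map⁺)
open import Data.List.Relation.Binary.Permutation.Propositional using (_↭_; ↭-refl; ↭-trans; ↭-swap; ↭-prep; ↭-sym; ↭⇒↭ₛ)
import Data.List.Relation.Binary.Permutation.Propositional.Properties as Perm
open Perm using (All-resp-↭)
import Data.List.Relation.Binary.Permutation.Setoid.Properties
open import Data.Product using (Σ; _×_; _,_; proj₁; proj₂; ∃-syntax)
open import Data.Sum using (_⊎_; inj₁; inj₂)
open import Data.Unit using (⊤; tt)
open import Data.Empty using (⊥-elim)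
open import Function using (_∘_)
open import Relation.Binary.PropositionalEquality hiding ([_])
open import Relation.Binary.Definitions using (tri<; tri≈; tri>)
open import Relation.Nullary using (¬_; yes; no; ¬?; _×-dec_)
open import Relation.Unary using (Decidable)

-- Arithmetic

x+x≡2*x : ∀ x → x + x ≡ 2 * x
x+x≡2*x x = cong (x +_) (sym (+-identityʳ x))

m+o≡n⇒m≤n : ∀ {m n} o → m + o ≡ n → m ≤ n
m+o≡n⇒m≤n {m} o m+o≡n = subst (m ≤_) m+o≡n (m≤m+n m o)

k*m<N≤k*P⇒m<P : ∀ {P} k m {N} .{{_ : NonZero k}} → k * m < N → N ≤ k * P → m < P
k*m<N≤k*P⇒m<P {P} k m km<N N≤kP = *-cancelˡ-< k m P (<-≤-trans km<N N≤kP)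

n≰m⇒m∸n≡0 : ∀ {m n} → n ≰ m → m ∸ n ≡ 0
n≰m⇒m∸n≡0 n≰m = m≤n⇒m∸n≡0 (<⇒≤ (≰⇒> n≰m))

≤⌊/2⌋ : ∀ {a n} → a + a ≤ n → a ≤ ⌊ n /2⌋
≤⌊/2⌋ {a} a+a≤n = subst (_≤ _) (sym (n≡⌊n+n/2⌋ a)) (⌊n/2⌋-mono a+a≤n)

⌊b+b+n/2⌋≡b+⌊n/2⌋ : ∀ b n → ⌊ b + b + n /2⌋ ≡ b + ⌊ n /2⌋
⌊b+b+n/2⌋≡b+⌊n/2⌋ zero    n = refl
⌊b+b+n/2⌋≡b+⌊n/2⌋ (suc b) n =
  trans (cong (λ m → ⌊ suc (m + n) /2⌋) (+-suc b b)) (cong suc (⌊b+b+n/2⌋≡b+⌊n/2⌋ b n))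

⌈b+b+n/2⌉≡b+⌈n/2⌉ : ∀ b n → ⌈ b + b + n /2⌉ ≡ b + ⌈ n /2⌉
⌈b+b+n/2⌉≡b+⌈n/2⌉ b n = trans (cong ⌊_/2⌋ (sym (+-suc (b + b) n))) (⌊b+b+n/2⌋≡b+⌊n/2⌋ b (suc n))

≤b+⌊n/2⌋ : ∀ {a} b n → a + a ≤ b + b + n → a ≤ b + ⌊ n /2⌋
≤b+⌊n/2⌋ {a} b n a+a≤ = subst (a ≤_) (⌊b+b+n/2⌋≡b+⌊n/2⌋ b n) (≤⌊/2⌋ a+a≤)

⌊a+b/2⌋≤⌈a/2⌉+⌊b/2⌋ : ∀ a b → ⌊ a + b /2⌋ ≤ ⌈ a /2⌉ + ⌊ b /2⌋
⌊a+b/2⌋≤⌈a/2⌉+⌊b/2⌋ zero          b = ≤-refl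
⌊a+b/2⌋≤⌈a/2⌉+⌊b/2⌋ (suc zero)    b = ⌊n/2⌋-mono (n≤1+n (suc b))
⌊a+b/2⌋≤⌈a/2⌉+⌊b/2⌋ (suc (suc a)) b = s≤s (⌊a+b/2⌋≤⌈a/2⌉+⌊b/2⌋ a b)

⌊a+b/2⌋≤⌊a/2⌋+⌈b/2⌉ : ∀ a b → ⌊ a + b /2⌋ ≤ ⌊ a /2⌋ + ⌈ b /2⌉
⌊a+b/2⌋≤⌊a/2⌋+⌈b/2⌉ a b = subst₂ _≤_ (cong ⌊_/2⌋ (+-comm b a)) (+-comm ⌈ b /2⌉ ⌊ a /2⌋) (⌊a+b/2⌋≤⌈a/2⌉+⌊b/2⌋ b a)

⌈a/2⌉+⌊b/2⌋≤⌈a+b/2⌉ : ∀ a b → ⌈ a /2⌉ + ⌊ b /2⌋ ≤ ⌈ a + b /2⌉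
⌈a/2⌉+⌊b/2⌋≤⌈a+b/2⌉ zero          b = ⌊n/2⌋≤⌈n/2⌉ b
⌈a/2⌉+⌊b/2⌋≤⌈a+b/2⌉ (suc zero)    b = ≤-refl
⌈a/2⌉+⌊b/2⌋≤⌈a+b/2⌉ (suc (suc a)) b = s≤s (⌈a/2⌉+⌊b/2⌋≤⌈a+b/2⌉ a b)

⌈n+n/2⌉≡n : ∀ n → ⌈ n + n /2⌉ ≡ n
⌈n+n/2⌉≡n n = +-cancelˡ-≡ n _ _ (begin
  n + ⌈ n + n /2⌉            ≡⟨ cong (_+ ⌈ n + n /2⌉) (n≡⌊n+n/2⌋ n) ⟩
  ⌊ n + n /2⌋ + ⌈ n + n /2⌉  ≡⟨ ⌊n/2⌋+⌈n/2⌉≡n (n + n) ⟩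
  n + n                      ∎)
  where open ≡-Reasoning

⌈a/2⌉+⌊b/2⌋≡half : ∀ a b {c} → a + b ≡ c + c → ⌈ a /2⌉ + ⌊ b /2⌋ ≡ c
⌈a/2⌉+⌊b/2⌋≡half a b {c} a+b≡2c = ≤-antisym
  (subst (⌈ a /2⌉ + ⌊ b /2⌋ ≤_) (trans (cong ⌈_/2⌉ a+b≡2c) (⌈n+n/2⌉≡n c)) (⌈a/2⌉+⌊b/2⌋≤⌈a+b/2⌉ a b))
  (subst (_≤ ⌈ a /2⌉ + ⌊ b /2⌋) (trans (cong ⌊_/2⌋ a+b≡2c) (sym (n≡⌊n+n/2⌋ c))) (⌊a+b/2⌋≤⌈a/2⌉+⌊b/2⌋ a b))

⌊a/2⌋+⌈b/2⌉≡half : ∀ a b {c} → a + b ≡ c + c → ⌊ a /2⌋ + ⌈ b /2⌉ ≡ c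
⌊a/2⌋+⌈b/2⌉≡half a b a+b≡2c = trans (+-comm ⌊ a /2⌋ ⌈ b /2⌉) (⌈a/2⌉+⌊b/2⌋≡half b a (trans (+-comm b a) a+b≡2c))

⌊y/2⌋≤x⇒y≤1+2x : ∀ {x} y → ⌊ y /2⌋ ≤ x → y ≤ suc (2 * x)
⌊y/2⌋≤x⇒y≤1+2x {x} y ⌊y/2⌋≤x = begin
  y                         ≡⟨ sym (⌊n/2⌋+⌈n/2⌉≡n y) ⟩
  ⌊ y /2⌋ + ⌈ y /2⌉         ≤⟨ +-mono-≤ ⌊y/2⌋≤x (≤-trans (⌊n/2⌋-mono (n≤1+n (suc y))) (s≤s ⌊y/2⌋≤x)) ⟩
  x + suc x                 ≡⟨ +-suc x x ⟩
  suc (x + x)               ≡⟨ cong suc (x+x≡2*x x) ⟩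
  suc (2 * x)               ∎
  where open ≤-Reasoning

⌊w/2⌋<m : ∀ {w m} → w < 2 * m → ⌊ w /2⌋ < m
⌊w/2⌋<m {w} {m} w<2m = *-cancelˡ-< 2 ⌊ w /2⌋ m (≤-<-trans (begin
  2 * ⌊ w /2⌋               ≡⟨ sym (x+x≡2*x ⌊ w /2⌋) ⟩
  ⌊ w /2⌋ + ⌊ w /2⌋         ≤⟨ +-monoʳ-≤ ⌊ w /2⌋ (⌊n/2⌋≤⌈n/2⌉ w) ⟩
  ⌊ w /2⌋ + ⌈ w /2⌉         ≡⟨ ⌊n/2⌋+⌈n/2⌉≡n w ⟩
  w                         ∎) w<2m)
  where open ≤-Reasoning

⌊2*v/2⌋≡v : ∀ v → ⌊ 2 * v /2⌋ ≡ v
⌊2*v/2⌋≡v v = trans (cong ⌊_/2⌋ (sym (x+x≡2*x v))) (sym (n≡⌊n+n/2⌋ v))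

⌊1+2*v/2⌋≡v : ∀ v → ⌊ suc (2 * v) /2⌋ ≡ v
⌊1+2*v/2⌋≡v v = trans (cong ⌈_/2⌉ (sym (x+x≡2*x v))) (⌈n+n/2⌉≡n v)

⌊w/2⌋≡v⇒ : ∀ {w v} → ⌊ w /2⌋ ≡ v → w ≡ 2 * v ⊎ w ≡ suc (2 * v)
⌊w/2⌋≡v⇒ {zero}        refl = inj₁ refl
⌊w/2⌋≡v⇒ {suc zero}    refl = inj₂ refl
⌊w/2⌋≡v⇒ {suc (suc w)} refl with ⌊w/2⌋≡v⇒ {w} refl
... | inj₁ w≡2v   = inj₁ (trans (cong (2 +_) w≡2v) (sym (*-distribˡ-+ 2 1 ⌊ w /2⌋)))
... | inj₂ w≡1+2v = inj₂ (trans (cong (2 +_) w≡1+2v) (cong suc (sym (*-distribˡ-+ 2 1 ⌊ w /2⌋))))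

/2≡⌊/2⌋ : ∀ w → w / 2 ≡ ⌊ w /2⌋
/2≡⌊/2⌋ zero          = refl
/2≡⌊/2⌋ (suc zero)    = refl
/2≡⌊/2⌋ (suc (suc w)) = trans (m/n≡1+[m∸n]/n {suc (suc w)} {2} (s≤s (s≤s z≤n))) (cong suc (/2≡⌊/2⌋ w))

2*v≢1+2*v : ∀ v → 2 * v ≢ suc (2 * v)
2*v≢1+2*v v eq = <-irrefl eq (n<1+n (2 * v))

-- Sums and ranges

sumTo-cong : ∀ ℓ {f g} → (∀ j → 1 ≤ j → j ≤ ℓ → f j ≡ g j) → sumTo ℓ f ≡ sumTo ℓ g
sumTo-cong zero    _     = refl
sumTo-cong (suc ℓ) f≗g = cong₂ _+_ (sumTo-cong ℓ (λ j 1≤j j≤ℓ → f≗g j 1≤j (m≤n⇒m≤1+n j≤ℓ))) (f≗g (suc ℓ) (s≤s z≤n) ≤-refl)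

sumTo-+ : ∀ ℓ f g → sumTo ℓ (λ i → f i + g i) ≡ sumTo ℓ f + sumTo ℓ g
sumTo-+ zero    f g = refl
sumTo-+ (suc ℓ) f g = trans (cong (_+ (f (suc ℓ) + g (suc ℓ))) (sumTo-+ ℓ f g)) (regroup (sumTo ℓ f) (sumTo ℓ g) (f (suc ℓ)) (g (suc ℓ)))
  where
  regroup : ∀ a b c d → a + b + (c + d) ≡ a + c + (b + d)
  regroup = solve-∀

sumTo-zero : ∀ ℓ → sumTo ℓ (λ _ → 0) ≡ 0
sumTo-zero zero    = refl
sumTo-zero (suc ℓ) = trans (+-identityʳ _) (sumTo-zero ℓ)

sumTo-front : ∀ n f → sumTo (suc n) f ≡ f 1 + sumTo n (f ∘ suc)
sumTo-front zero    f = sym (+-identityʳ (f 1))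
sumTo-front (suc n) f = trans (cong (_+ f (2 + n)) (sumTo-front n f)) (+-assoc (f 1) _ _)

*≤sum-take : ∀ {c} p vs → All (c ≤_) vs → p ≤ length vs → p * c ≤ sum (take p vs)
*≤sum-take zero    vs       _            _          = z≤n
*≤sum-take (suc p) (v ∷ vs) (c≤v ∷ c≤vs) (s≤s p≤∣vs∣) = +-mono-≤ c≤v (*≤sum-take p vs c≤vs p≤∣vs∣)

length-rangeFrom : ∀ a k → length (rangeFrom a k) ≡ k
length-rangeFrom a zero    = refl
length-rangeFrom a (suc k) = cong suc (length-rangeFrom (suc a) k)

∈-rangeFrom⁺ : ∀ {i} a k → a ≤ i → i < a + k → i ∈ rangeFrom a k
∈-rangeFrom⁺ {i} a zero    a≤i i<a+0 = ⊥-elim (<⇒≱ (subst (i <_) (+-identityʳ a) i<a+0) a≤i)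
∈-rangeFrom⁺ {i} a (suc k) a≤i i<a+k with a ≟ i
... | yes a≡i = here (sym a≡i)
... | no  a≢i = there (∈-rangeFrom⁺ (suc a) k (≤∧≢⇒< a≤i a≢i) (subst (i <_) (+-suc a k) i<a+k))

∈-rangeFrom⁻ : ∀ {i} a k → i ∈ rangeFrom a k → a ≤ i × i < a + k
∈-rangeFrom⁻ a (suc k) (here refl) = ≤-refl , m<m+n a z<s
∈-rangeFrom⁻ {i} a (suc k) (there i∈) with ∈-rangeFrom⁻ (suc a) k i∈
... | a<i , i<1+a+k = <⇒≤ a<i , subst (i <_) (sym (+-suc a k)) i<1+a+k

unique-rangeFrom : ∀ a k → Unique (rangeFrom a k)
unique-rangeFrom a zero    = []
unique-rangeFrom a (suc k) = All.tabulate (λ i∈ → <⇒≢ (proj₁ (∈-rangeFrom⁻ (suc a) k i∈))) ∷ unique-rangeFrom (suc a) k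

take-rangeFrom : ∀ a {k n} → k ≤ n → take k (rangeFrom a n) ≡ rangeFrom a k
take-rangeFrom a {zero}  _         = refl
take-rangeFrom a {suc k} (s≤s k≤n) = cong (a ∷_) (take-rangeFrom (suc a) k≤n)

rangeFrom-∷ʳ : ∀ a k → rangeFrom a (suc k) ≡ rangeFrom a k ∷ʳ (a + k)
rangeFrom-∷ʳ a zero    = cong [_] (sym (+-identityʳ a))
rangeFrom-∷ʳ a (suc k) = cong (a ∷_) (trans (rangeFrom-∷ʳ (suc a) k) (cong (rangeFrom (suc a) k ∷ʳ_) (sym (+-suc a k))))

rangeFrom-+ : ∀ a m m′ → rangeFrom a (m + m′) ≡ rangeFrom a m ++ rangeFrom (a + m) m′
rangeFrom-+ a zero    m′ = cong (λ b → rangeFrom b m′) (sym (+-identityʳ a))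
rangeFrom-+ a (suc m) m′ = cong (a ∷_) (trans (rangeFrom-+ (suc a) m m′) (cong (λ b → rangeFrom (suc a) m ++ rangeFrom b m′) (sym (+-suc a m))))

sum-rangeFrom : ∀ f k → sum (map f (rangeFrom 1 k)) ≡ sumTo k f
sum-rangeFrom f zero    = refl
sum-rangeFrom f (suc k) = begin
  sum (map f (rangeFrom 1 (suc k)))              ≡⟨ cong (sum ∘ map f) (rangeFrom-∷ʳ 1 k) ⟩
  sum (map f (rangeFrom 1 k ++ [ suc k ]))       ≡⟨ cong sum (List.map-++ f (rangeFrom 1 k) [ suc k ]) ⟩
  sum (map f (rangeFrom 1 k) ++ [ f (suc k) ])   ≡⟨ sum-++ (map f (rangeFrom 1 k)) [ f (suc k) ] ⟩
  sum (map f (rangeFrom 1 k)) + (f (suc k) + 0)  ≡⟨ cong₂ _+_ (sum-rangeFrom f k) (+-identityʳ _) ⟩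
  sumTo k f + f (suc k)                          ∎
  where open ≡-Reasoning

length≤1+length-filter-≢ : ∀ x {xs : List ℕ} → Unique xs → length xs ≤ suc (length (filter (¬? ∘ (_≟ x)) xs))
length≤1+length-filter-≢ x {[]}     _                 = z≤n
length≤1+length-filter-≢ x {y ∷ xs} (y∉xs ∷ unique) with y ≟ x
... | yes refl = s≤s (≤-reflexive (sym (cong length (trans (List.filter-reject (¬? ∘ (_≟ y)) (λ y≢y → y≢y refl))
                                                                (List.filter-all (¬? ∘ (_≟ y)) (All.map (λ y≢z z≡y → y≢z (sym z≡y)) y∉xs))))))
... | no  y≢x  = subst (λ zs → suc (length xs) ≤ suc (length zs)) (sym (List.filter-accept (¬? ∘ (_≟ x)) y≢x))
                       (s≤s (length≤1+length-filter-≢ x unique))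

pigeonhole : ∀ ℓ h {xs} → Unique xs → All (λ a → ℓ < a × a ≤ h) xs → length xs ≤ h ∸ ℓ
pigeonhole ℓ h       {[]}    _      _                      = z≤n
pigeonhole ℓ zero    {_ ∷ _} _      ((ℓ<a , a≤0) ∷ _)      = ⊥-elim (<⇒≱ (<-≤-trans ℓ<a a≤0) z≤n)
pigeonhole ℓ (suc h) {xs@(a ∷ _)} unique in-range@((ℓ<a , a≤1+h) ∷ _) = begin
  length xs                      ≤⟨ length≤1+length-filter-≢ (suc h) unique ⟩
  suc (length xs′)               ≤⟨ s≤s (pigeonhole ℓ h (Unique.filter⁺ (¬? ∘ (_≟ suc h)) unique) below-h) ⟩
  suc (h ∸ ℓ)                    ≡⟨ sym (+-∸-assoc 1 ℓ≤h) ⟩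
  suc h ∸ ℓ                      ∎
  where
  open ≤-Reasoning
  xs′ = filter (¬? ∘ (_≟ suc h)) xs
  ℓ≤h : ℓ ≤ h
  ℓ≤h = ≤-pred (<-≤-trans ℓ<a a≤1+h)
  below-h : All (λ a → ℓ < a × a ≤ h) xs′
  below-h = All.zipWith (λ { ((ℓ<b , b≤1+h) , b≢1+h) → ℓ<b , ≤-pred (≤∧≢⇒< b≤1+h b≢1+h) })
                        (filter⁺ (¬? ∘ (_≟ suc h)) in-range , all-filter (¬? ∘ (_≟ suc h)) xs)

-- Sizes and deficits

size : ℕ → ℕ
size n = sumTo n (2 ^_)

size+2 : ∀ n → size n + 2 ≡ 2 ^ suc n
size+2 zero    = refl
size+2 (suc n) = begin
  size n + 2 ^ suc n + 2    ≡⟨ swap (size n) (2 ^ suc n) ⟩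
  size n + 2 + 2 ^ suc n    ≡⟨ cong (_+ 2 ^ suc n) (size+2 n) ⟩
  2 ^ suc n + 2 ^ suc n     ≡⟨ x+x≡2*x (2 ^ suc n) ⟩
  2 ^ suc (suc n)           ∎
  where
  open ≡-Reasoning
  swap : ∀ g x → g + x + 2 ≡ g + 2 + x
  swap = solve-∀

size-suc : ∀ n → size (suc n) ≡ 2 + 2 * size n
size-suc n = begin
  size n + 2 ^ suc n        ≡⟨ cong (size n +_) (sym (size+2 n)) ⟩
  size n + (size n + 2)     ≡⟨ collect (size n) ⟩
  2 + 2 * size n            ∎
  where
  open ≡-Reasoning
  collect : ∀ g → g + (g + 2) ≡ 2 + 2 * g
  collect = solve-∀

size-3+ : ∀ p → size (3 + p) ≡ 14 + 8 * size p
size-3+ p = begin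
  size (3 + p)                          ≡⟨ size-suc (2 + p) ⟩
  2 + 2 * size (2 + p)                  ≡⟨ cong (λ g → 2 + 2 * g) (size-suc (1 + p)) ⟩
  2 + 2 * (2 + 2 * size (1 + p))        ≡⟨ cong (λ g → 2 + 2 * (2 + 2 * g)) (size-suc p) ⟩
  2 + 2 * (2 + 2 * (2 + 2 * size p))    ≡⟨ expand (size p) ⟩
  14 + 8 * size p                       ∎
  where
  open ≡-Reasoning
  expand : ∀ g → 2 + 2 * (2 + 2 * (2 + 2 * g)) ≡ 14 + 8 * g
  expand = solve-∀

deficit : ℕ → ℕ → ℕ
deficit n s = sumTo n (λ j → s ∸ 2 ^ j)

deficit-mono : ∀ {m n} s → m ≤′ n → deficit m s ≤ deficit n s
deficit-mono s ≤′-refl       = ≤-refl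
deficit-mono s (≤′-step m≤n) = ≤-trans (deficit-mono s m≤n) (m≤m+n _ _)

*≤deficit+size : ∀ k s → k * s ≤ deficit k s + size k
*≤deficit+size zero    s = z≤n
*≤deficit+size (suc k) s = begin
  s + k * s                                        ≤⟨ +-mono-≤ (m≤n+m∸n s (2 ^ suc k)) (*≤deficit+size k s) ⟩
  (2 ^ suc k + (s ∸ 2 ^ suc k)) + (deficit k s + size k)  ≡⟨ shuffle (2 ^ suc k) (s ∸ 2 ^ suc k) (deficit k s) (size k) ⟩
  deficit k s + (s ∸ 2 ^ suc k) + (size k + 2 ^ suc k)   ∎
  where
  open ≤-Reasoning
  shuffle : ∀ a b d g → (a + b) + (d + g) ≡ d + b + (g + a)
  shuffle = solve-∀

deficit-below : ∀ d k → d ≤ k → deficit d (2 ^ k) + size d ≡ d * 2 ^ k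
deficit-below zero    k _    = refl
deficit-below (suc d) k d<k = begin
  deficit d (2 ^ k) + (2 ^ k ∸ 2 ^ suc d) + (size d + 2 ^ suc d)   ≡⟨ shuffle (deficit d (2 ^ k)) (2 ^ k ∸ 2 ^ suc d) (size d) (2 ^ suc d) ⟩
  (deficit d (2 ^ k) + size d) + (2 ^ k ∸ 2 ^ suc d + 2 ^ suc d)   ≡⟨ cong₂ _+_ (deficit-below d k (<⇒≤ d<k)) (m∸n+n≡m (^-monoʳ-≤ 2 d<k)) ⟩
  d * 2 ^ k + 2 ^ k                                                ≡⟨ +-comm (d * 2 ^ k) (2 ^ k) ⟩
  suc d * 2 ^ k                                                    ∎
  where
  open ≡-Reasoning
  shuffle : ∀ a b c e → a + b + (c + e) ≡ (a + c) + (b + e)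
  shuffle = solve-∀

deficit-above : ∀ k {n} → k ≤′ n → deficit n (2 ^ k) ≡ deficit k (2 ^ k)
deficit-above k ≤′-refl       = refl
deficit-above k {suc n} (≤′-step k≤n) = begin
  deficit n (2 ^ k) + (2 ^ k ∸ 2 ^ suc n)   ≡⟨ cong (deficit n (2 ^ k) +_) (m≤n⇒m∸n≡0 (^-monoʳ-≤ 2 (m≤n⇒m≤1+n (≤′⇒≤ k≤n)))) ⟩
  deficit n (2 ^ k) + 0                      ≡⟨ +-identityʳ _ ⟩
  deficit n (2 ^ k)                          ≡⟨ deficit-above k k≤n ⟩
  deficit k (2 ^ k)                          ∎
  where open ≡-Reasoning

deficit-pow : ∀ k n → k ≤ n → deficit n (2 ^ k) + size k ≡ k * 2 ^ k
deficit-pow k n k≤n = trans (cong (_+ size k) (deficit-above k (≤⇒≤′ k≤n))) (deficit-below k k ≤-refl)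

deficitOf : List ℕ → ℕ → ℕ
deficitOf vs s = sum (map (s ∸_) vs)

Majorised : ℕ → List ℕ → Set
Majorised n vs = ∀ s → deficitOf vs s ≤ deficit n s

*≤deficitOf+sum-take : ∀ k vs s → k ≤ length vs → k * s ≤ deficitOf vs s + sum (take k vs)
*≤deficitOf+sum-take zero    vs       s _           = z≤n
*≤deficitOf+sum-take (suc k) (v ∷ vs) s (s≤s k≤∣vs∣) = begin
  s + k * s                                               ≤⟨ +-mono-≤ (m≤n+m∸n s v) (*≤deficitOf+sum-take k vs s k≤∣vs∣) ⟩
  (v + (s ∸ v)) + (deficitOf vs s + sum (take k vs))     ≡⟨ shuffle v (s ∸ v) (deficitOf vs s) (sum (take k vs)) ⟩
  (s ∸ v) + deficitOf vs s + (v + sum (take k vs))       ∎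
  where
  open ≤-Reasoning
  shuffle : ∀ a b d t → (a + b) + (d + t) ≡ b + d + (a + t)
  shuffle = solve-∀

majorised⇒prefix : ∀ {n vs} → Majorised n vs → length vs ≡ n → ∀ k → k ≤ n → size k ≤ sum (take k vs)
majorised⇒prefix {n} {vs} maj refl k k≤n = +-cancelˡ-≤ (deficit n (2 ^ k)) (size k) (sum (take k vs)) (begin
  deficit n (2 ^ k) + size k              ≡⟨ deficit-pow k n k≤n ⟩
  k * 2 ^ k                               ≤⟨ *≤deficitOf+sum-take k vs (2 ^ k) k≤n ⟩
  deficitOf vs (2 ^ k) + sum (take k vs)  ≤⟨ +-monoˡ-≤ (sum (take k vs)) (maj (2 ^ k)) ⟩
  deficit n (2 ^ k) + sum (take k vs)     ∎)
  where open ≤-Reasoning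

deficit-bound : ∀ {n t V S} k → V + S ≡ k * t → size k ≤ S → k ≤ n → V ≤ deficit n t
deficit-bound {n} {t} {V} {S} k V+S≡kt size≤S k≤n = ≤-trans V≤deficit (deficit-mono t (≤⇒≤′ k≤n))
  where
  V≤deficit : V ≤ deficit k t
  V≤deficit = +-cancelʳ-≤ (size k) V (deficit k t) (begin
    V + size k           ≤⟨ +-monoʳ-≤ V size≤S ⟩
    V + S                ≡⟨ V+S≡kt ⟩
    k * t                ≤⟨ *≤deficit+size k t ⟩
    deficit k t + size k ∎)
    where open ≤-Reasoning

deficit-∷ : ∀ {t a V S} k → a ≤ t → V + S ≡ k * t → (t ∸ a) + V + (a + S) ≡ suc k * t
deficit-∷ {t} {a} {V} {S} k a≤t V+S≡kt = begin
  (t ∸ a) + V + (a + S)    ≡⟨ shuffle (t ∸ a) V a S ⟩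
  (t ∸ a + a) + (V + S)    ≡⟨ cong₂ _+_ (m∸n+n≡m a≤t) V+S≡kt ⟩
  t + k * t                ∎
  where
  open ≡-Reasoning
  shuffle : ∀ x V a S → x + V + (a + S) ≡ (x + a) + (V + S)
  shuffle = solve-∀

deficitOf-above : ∀ {t vs} → All (t ≤_) vs → deficitOf vs t ≡ 0
deficitOf-above []             = refl
deficitOf-above (t≤v ∷ t≤vs) = cong₂ _+_ (m≤n⇒m∸n≡0 t≤v) (deficitOf-above t≤vs)

deficitOf-split : ∀ {t} p vs → p ≤ length vs → All (_≤ t) (take p vs) → All (t ≤_) (drop p vs) →
                  deficitOf vs t + sum (take p vs) ≡ p * t
deficitOf-split zero    vs       _          _             t≤vs = trans (+-identityʳ _) (deficitOf-above t≤vs)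
deficitOf-split (suc p) (v ∷ vs) (s≤s p≤∣vs∣) (v≤t ∷ below) above = deficit-∷ p v≤t (deficitOf-split p vs p≤∣vs∣ below above)

Sorted : List ℕ → Set
Sorted = AllPairs _≤_

record Threshold (u : ℕ) (vs : List ℕ) : Set where
  field
    index   : ℕ
    index≤  : index ≤ length vs
    below   : All (_< u) (take index vs)
    above   : All (u ≤_) (drop index vs)

sorted-threshold : ∀ {vs} → Sorted vs → ∀ u → Threshold u vs
sorted-threshold []                    u = record { index = 0 ; index≤ = z≤n ; below = [] ; above = [] }
sorted-threshold {v ∷ vs} (v≤vs ∷ sorted) u with v <? u
... | no  v≮u = record { index = 0 ; index≤ = z≤n ; below = [] ; above = u≤v ∷ All.map (≤-trans u≤v) v≤vs }
  where u≤v = ≮⇒≥ v≮u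
... | yes v<u = record { index = suc index ; index≤ = s≤s index≤ ; below = v<u ∷ below ; above = above }
  where open Threshold (sorted-threshold sorted u)

prefix⇒majorised : ∀ {vs} → Sorted vs → (∀ k → k ≤ length vs → size k ≤ sum (take k vs)) → Majorised (length vs) vs
prefix⇒majorised {vs} sorted prefix t = deficit-bound index split (prefix index index≤) index≤
  where
  open Threshold (sorted-threshold sorted t)
  split = deficitOf-split index vs index≤ (All.map <⇒≤ below) above

deficit-bound₂ : ∀ {m t V S p} a₁ a₂ → V + S ≡ p * t → 2 + p ≤ m →
                 size p ≤ S → size (1 + p) ≤ a₁ + S → size (1 + p) ≤ a₂ + S → size (2 + p) ≤ a₁ + (a₂ + S) →
                 (t ∸ a₁) + ((t ∸ a₂) + V) ≤ deficit m t
deficit-bound₂ {m} {t} {V} {S} {p} a₁ a₂ V+S≡pt 2+p≤m s₀ s₁ s₂ s₁₂ with a₁ ≤? t | a₂ ≤? t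
... | yes a₁≤t | yes a₂≤t = deficit-bound (2 + p) (deficit-∷ (1 + p) a₁≤t (deficit-∷ p a₂≤t V+S≡pt)) s₁₂ 2+p≤m
... | yes a₁≤t | no  a₂≰t = subst (λ z → (t ∸ a₁) + (z + V) ≤ deficit m t) (sym (n≰m⇒m∸n≡0 a₂≰t))
                                (deficit-bound (1 + p) (deficit-∷ p a₁≤t V+S≡pt) s₁ (≤-trans (n≤1+n _) 2+p≤m))
... | no  a₁≰t | yes a₂≤t = subst (λ z → z + ((t ∸ a₂) + V) ≤ deficit m t) (sym (n≰m⇒m∸n≡0 a₁≰t))
                                (deficit-bound (1 + p) (deficit-∷ p a₂≤t V+S≡pt) s₂ (≤-trans (n≤1+n _) 2+p≤m))
... | no  a₁≰t | no  a₂≰t = subst₂ (λ z w → z + (w + V) ≤ deficit m t) (sym (n≰m⇒m∸n≡0 a₁≰t)) (sym (n≰m⇒m∸n≡0 a₂≰t))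
                                (deficit-bound p V+S≡pt s₀ (≤-trans (≤-trans (n≤1+n _) (n≤1+n _)) 2+p≤m))

p*size≤[3+p]*P : ∀ {c₁ c₂ c₃ P} p → c₁ ≤ c₂ → c₂ ≤ c₃ → p * c₃ ≤ P →
                 size (3 + p) ≤ c₁ + (c₂ + (c₃ + P)) → p * size (3 + p) ≤ (3 + p) * P
p*size≤[3+p]*P {c₁} {c₂} {c₃} {P} p c₁≤c₂ c₂≤c₃ pc₃≤P prefix = begin
  p * size (3 + p)                   ≤⟨ *-monoʳ-≤ p prefix ⟩
  p * (c₁ + (c₂ + (c₃ + P)))         ≡⟨ expand p c₁ c₂ c₃ P ⟩
  p * c₁ + p * c₂ + p * c₃ + p * P   ≤⟨ +-monoˡ-≤ (p * P) (+-monoˡ-≤ (p * c₃) (+-mono-≤ (*-monoʳ-≤ p (≤-trans c₁≤c₂ c₂≤c₃)) (*-monoʳ-≤ p c₂≤c₃))) ⟩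
  p * c₃ + p * c₃ + p * c₃ + p * P   ≤⟨ +-monoˡ-≤ (p * P) (+-mono-≤ (+-mono-≤ pc₃≤P pc₃≤P) pc₃≤P) ⟩
  P + P + P + p * P                  ≡⟨ collect p P ⟩
  (3 + p) * P                        ∎
  where
  open ≤-Reasoning
  expand : ∀ p a b c P → p * (a + (b + (c + P))) ≡ p * a + p * b + p * c + p * P
  expand = solve-∀
  collect : ∀ p P → P + P + P + p * P ≡ (3 + p) * P
  collect = solve-∀

p*size≤[1+p]*[c₁+c₂+P] : ∀ {c₁ c₂ c₃ P} p → p * c₃ ≤ P →
                         size (3 + p) ≤ c₁ + (c₂ + (c₃ + P)) → p * size (3 + p) ≤ (1 + p) * (c₁ + c₂ + P)
p*size≤[1+p]*[c₁+c₂+P] {c₁} {c₂} {c₃} {P} p pc₃≤P prefix = begin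
  p * size (3 + p)                         ≤⟨ *-monoʳ-≤ p prefix ⟩
  p * (c₁ + (c₂ + (c₃ + P)))               ≡⟨ expand p c₁ c₂ c₃ P ⟩
  p * (c₁ + c₂ + P) + p * c₃               ≤⟨ +-monoʳ-≤ (p * (c₁ + c₂ + P)) (≤-trans pc₃≤P (m≤n+m P (c₁ + c₂))) ⟩
  p * (c₁ + c₂ + P) + (c₁ + c₂ + P)        ≡⟨ +-comm (p * (c₁ + c₂ + P)) _ ⟩
  (1 + p) * (c₁ + c₂ + P)                  ∎
  where
  open ≤-Reasoning
  expand : ∀ p a b c P → p * (a + (b + (c + P))) ≡ p * (a + b + P) + p * c
  expand = solve-∀

double-size≤ : ∀ {P} p → p * size (3 + p) ≤ (3 + p) * P → size p + size p ≤ P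
double-size≤ zero    _     = z≤n
double-size≤ (suc q) bound = *-cancelˡ-≤ (4 + q) (≤-trans numeric bound)
  where
  g = size (suc q)
  numeric : (4 + q) * (g + g) ≤ suc q * size (4 + q)
  numeric = m+o≡n⇒m≤n (14 + 14 * q + 6 * q * g) (trans (identity q g) (cong (suc q *_) (sym (size-3+ (suc q)))))
    where
    identity : ∀ q g → (4 + q) * (g + g) + (14 + 14 * q + 6 * q * g) ≡ suc q * (14 + 8 * g)
    identity = solve-∀

-- For p = 1, 2 the bound uses that P is an integer: 4 · 7 < size 4 ≤ 4 P and 5 · 23 < 2 · size 5 ≤ 5 P.
double-size-suc≤ : ∀ {P} p → p * size (3 + p) ≤ (3 + p) * P → size (1 + p) + size (1 + p) ≤ 4 + P
double-size-suc≤         zero                bound = m≤m+n 4 _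
double-size-suc≤         (suc zero)          bound = +-monoʳ-≤ 4 (k*m<N≤k*P⇒m<P 4 7 (m+o≡n⇒m≤n 1 refl) bound)
double-size-suc≤         (suc (suc zero))    bound = +-monoʳ-≤ 4 (k*m<N≤k*P⇒m<P 5 23 (m+o≡n⇒m≤n 8 refl) bound)
double-size-suc≤ {P} p@(suc (suc (suc q))) bound = begin
  size (1 + p) + size (1 + p)          ≡⟨ cong (λ s → s + s) (size-suc p) ⟩
  (2 + 2 * g) + (2 + 2 * g)            ≡⟨ regroup g ⟩
  4 + ((g + g) + (g + g))              ≤⟨ +-monoʳ-≤ 4 (*-cancelˡ-≤ (3 + p) (≤-trans numeric bound)) ⟩
  4 + P                                ∎
  where
  open ≤-Reasoning
  g = size p
  regroup : ∀ g → (2 + 2 * g) + (2 + 2 * g) ≡ 4 + ((g + g) + (g + g))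
  regroup = solve-∀
  numeric : (3 + p) * ((g + g) + (g + g)) ≤ p * size (3 + p)
  numeric = m+o≡n⇒m≤n (42 + 14 * q + 4 * q * g) (trans (identity q g) (cong (p *_) (sym (size-3+ p))))
    where
    identity : ∀ q g → (6 + q) * ((g + g) + (g + g)) + (42 + 14 * q + 4 * q * g) ≡ (3 + q) * (14 + 8 * g)
    identity = solve-∀

double-size-suc+2≤ : ∀ {Q} p → p * size (3 + p) ≤ (1 + p) * Q → 6 ≤ Q → size (1 + p) + size (1 + p) + 2 ≤ Q
double-size-suc+2≤     zero        _     6≤Q = 6≤Q
double-size-suc+2≤ {Q} p@(suc q) bound _   = *-cancelˡ-≤ (1 + p) (≤-trans numeric bound)
  where
  g = size p
  numeric : (1 + p) * (size (1 + p) + size (1 + p) + 2) ≤ p * size (3 + p)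
  numeric = m+o≡n⇒m≤n (2 + 8 * q + 4 * q * g) (trans (cong (λ s → (1 + p) * (s + s + 2) + (2 + 8 * q + 4 * q * g)) (size-suc p))
                                          (trans (identity q g) (cong (p *_) (sym (size-3+ p)))))
    where
    identity : ∀ q g → (2 + q) * ((2 + 2 * g) + (2 + 2 * g) + 2) + (2 + 8 * q + 4 * q * g) ≡ suc q * (14 + 8 * g)
    identity = solve-∀

-- Colour lists and halving

Entry : Set
Entry = ℕ × ℕ

colour quota : Entry → ℕ
colour = proj₁
quota  = proj₂

colours quotas : List Entry → List ℕ
colours = map colour
quotas  = map quota

δ : ℕ → ℕ → ℕ
δ k a with k ≟ a
... | yes _ = 1
... | no  _ = 0

δ-refl : ∀ k → δ k k ≡ 1
δ-refl k with k ≟ k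
... | yes _   = refl
... | no  k≢k = ⊥-elim (k≢k refl)

δ-≢ : ∀ {k a} → k ≢ a → δ k a ≡ 0
δ-≢ {k} {a} k≢a with k ≟ a
... | yes k≡a = ⊥-elim (k≢a k≡a)
... | no  _   = refl

multiplicity : List Entry → ℕ → ℕ
multiplicity L κ = sum (map (λ e → δ κ (colour e) * quota e) L)

multiplicity-↭ : ∀ {L M} → L ↭ M → ∀ κ → multiplicity L κ ≡ multiplicity M κ
multiplicity-↭ L↭M κ = sum-↭ (Perm.map⁺ _ L↭M)

∉⇒multiplicity≡0 : ∀ {κ} L → κ ∉ colours L → multiplicity L κ ≡ 0
∉⇒multiplicity≡0         []      _    = refl
∉⇒multiplicity≡0 {κ} (e ∷ L) κ∉L = cong₂ _+_ (cong (_* quota e) (δ-≢ (κ∉L ∘ here))) (∉⇒multiplicity≡0 L (κ∉L ∘ there))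

halfStep : ℕ → ℕ → ℕ
halfStep S v = ⌊ S + v /2⌋ ∸ ⌊ S /2⌋

⌊v/2⌋≤halfStep : ∀ S v → ⌊ v /2⌋ ≤ halfStep S v
⌊v/2⌋≤halfStep zero          v = ≤-refl
⌊v/2⌋≤halfStep (suc zero)    v = ⌊n/2⌋≤⌈n/2⌉ v
⌊v/2⌋≤halfStep (suc (suc S)) v = ⌊v/2⌋≤halfStep S v

halfStep≤⌈v/2⌉ : ∀ S v → halfStep S v ≤ ⌈ v /2⌉
halfStep≤⌈v/2⌉ zero          v = ⌊n/2⌋≤⌈n/2⌉ v
halfStep≤⌈v/2⌉ (suc zero)    v = ≤-refl
halfStep≤⌈v/2⌉ (suc (suc S)) v = halfStep≤⌈v/2⌉ S v

halfStep+halfStep : ∀ S v → halfStep S v + halfStep (suc S) v ≡ v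
halfStep+halfStep zero          v = ⌊n/2⌋+⌈n/2⌉≡n v
halfStep+halfStep (suc zero)    v = trans (+-comm ⌈ v /2⌉ ⌊ v /2⌋) (⌊n/2⌋+⌈n/2⌉≡n v)
halfStep+halfStep (suc (suc S)) v = halfStep+halfStep S v

-- S is the running sum of the quotas already split, so the quotas of halves 0 L and halves 1 L have as
-- prefix sums the floors and ceilings of the prefix sums of L (sum-take-halves).
halves : ℕ → List Entry → List Entry
halves S []      = []
halves S (e ∷ L) = (colour e , halfStep S (quota e)) ∷ halves (S + quota e) L

colours-halves : ∀ S L → colours (halves S L) ≡ colours L
colours-halves S []      = refl
colours-halves S (e ∷ L) = cong (colour e ∷_) (colours-halves (S + quota e) L)

length-halves : ∀ S L → length (halves S L) ≡ length L
length-halves S []      = refl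
length-halves S (e ∷ L) = cong suc (length-halves (S + quota e) L)

length-quotas-halves : ∀ S L → length (quotas (halves S L)) ≡ length (quotas L)
length-quotas-halves S []      = refl
length-quotas-halves S (e ∷ L) = cong suc (length-quotas-halves (S + quota e) L)

multiplicity-halves : ∀ S L κ → multiplicity (halves S L) κ + multiplicity (halves (suc S) L) κ ≡ multiplicity L κ
multiplicity-halves S []      κ = refl
multiplicity-halves S (e ∷ L) κ = begin
  (d * x + X) + (d * y + Y)    ≡⟨ regroup d x y X Y ⟩
  d * (x + y) + (X + Y)        ≡⟨ cong₂ (λ v R → d * v + R) (halfStep+halfStep S (quota e)) (multiplicity-halves (S + quota e) L κ) ⟩
  d * quota e + multiplicity L κ ∎
  where
  open ≡-Reasoning
  d = δ κ (colour e)
  x = halfStep S (quota e)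
  y = halfStep (suc S) (quota e)
  X = multiplicity (halves (S + quota e) L) κ
  Y = multiplicity (halves (suc S + quota e) L) κ
  regroup : ∀ d x y X Y → (d * x + X) + (d * y + Y) ≡ d * (x + y) + (X + Y)
  regroup = solve-∀

sum-take-halves : ∀ S p L → ⌊ S /2⌋ + sum (take p (quotas (halves S L))) ≡ ⌊ S + sum (take p (quotas L)) /2⌋
sum-take-halves S zero    L       = trans (+-identityʳ _) (cong ⌊_/2⌋ (sym (+-identityʳ S)))
sum-take-halves S (suc p) []      = trans (+-identityʳ _) (cong ⌊_/2⌋ (sym (+-identityʳ S)))
sum-take-halves S (suc p) (e ∷ L) = begin
  ⌊ S /2⌋ + (halfStep S v + T)          ≡⟨ sym (+-assoc ⌊ S /2⌋ (halfStep S v) T) ⟩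
  ⌊ S /2⌋ + halfStep S v + T            ≡⟨ cong (_+ T) (m+[n∸m]≡n (⌊n/2⌋-mono (m≤m+n S v))) ⟩
  ⌊ S + v /2⌋ + T                       ≡⟨ sum-take-halves (S + v) p L ⟩
  ⌊ S + v + sum (take p (quotas L)) /2⌋ ≡⟨ cong ⌊_/2⌋ (+-assoc S v _) ⟩
  ⌊ S + (v + sum (take p (quotas L))) /2⌋ ∎
  where
  open ≡-Reasoning
  v = quota e
  T = sum (take p (quotas (halves (S + v) L)))

sum-halves : ∀ S L → ⌊ S /2⌋ + sum (quotas (halves S L)) ≡ ⌊ S + sum (quotas L) /2⌋
sum-halves S L = subst₂ (λ X Y → ⌊ S /2⌋ + sum X ≡ ⌊ S + sum Y /2⌋)
                        (List.take-all (length (quotas L)) (quotas (halves S L)) (≤-reflexive (length-quotas-halves S L)))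
                        (List.take-all (length (quotas L)) (quotas L) ≤-refl)
                        (sum-take-halves S (length (quotas L)) L)

take-halves-≤ : ∀ {t} S p L → All (_< t + t) (take p (quotas L)) → All (_≤ t) (take p (quotas (halves S L)))
take-halves-≤ S zero    L       _            = []
take-halves-≤ S (suc p) []      _            = []
take-halves-≤ S (suc p) (e ∷ L) (v<2t ∷ vs<2t) =
  ≤-trans (halfStep≤⌈v/2⌉ S (quota e)) (subst (⌈ quota e /2⌉ ≤_) (sym (n≡⌊n+n/2⌋ _)) (⌊n/2⌋-mono v<2t))
  ∷ take-halves-≤ (S + quota e) p L vs<2t

drop-halves-≥ : ∀ {t} S p L → All (t + t ≤_) (drop p (quotas L)) → All (t ≤_) (drop p (quotas (halves S L)))
drop-halves-≥ S zero    []      []              = []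
drop-halves-≥ S zero    (e ∷ L) (2t≤v ∷ 2t≤vs) = ≤-trans (≤⌊/2⌋ 2t≤v) (⌊v/2⌋≤halfStep S (quota e)) ∷ drop-halves-≥ (S + quota e) zero L 2t≤vs
drop-halves-≥ S (suc p) []      _              = []
drop-halves-≥ S (suc p) (e ∷ L) 2t≤vs          = drop-halves-≥ (S + quota e) p L 2t≤vs

halves-deficit : ∀ {t} S L (th : Threshold (t + t) (quotas L)) →
                 deficitOf (quotas (halves S L)) t + sum (take (Threshold.index th) (quotas (halves S L))) ≡ Threshold.index th * t
halves-deficit S L th =
  deficitOf-split index (quotas (halves S L)) (subst (index ≤_) (sym (length-quotas-halves S L)) index≤)
                  (take-halves-≤ S index L below) (drop-halves-≥ S index L above)
  where open Threshold th

-- Coloured trees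

-- fork a b l r: the colourless root has children coloured a and b, with subtrees l and r below them.
data Tree : ℕ → Set where
  leaf : Tree 0
  fork : ∀ {n} → ℕ → ℕ → Tree n → Tree n → Tree (suc n)

count : ∀ {n} → ℕ → Tree n → ℕ
count κ leaf           = 0
count κ (fork a b l r) = δ κ a + δ κ b + count κ l + count κ r

AllNodes : ∀ {n} → (ℕ → Set) → Tree n → Set
AllNodes P leaf           = ⊤
AllNodes P (fork a b l r) = P a × P b × AllNodes P l × AllNodes P r

Ancestral : ∀ {n} → List ℕ → Tree n → Set
Ancestral As leaf           = ⊤
Ancestral As (fork a b l r) = a ∉ As × b ∉ As × Ancestral (a ∷ As) l × Ancestral (b ∷ As) r

count≡0⇒≢ : ∀ {n κ} (t : Tree n) → count κ t ≡ 0 → AllNodes (_≢ κ) t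
count≡0⇒≢     leaf           _   = tt
count≡0⇒≢ {κ = κ} (fork a b l r) ≡0 =
  δ≡0⇒≢ (m+n≡0⇒m≡0 (δ κ a) ab≡0) , δ≡0⇒≢ (m+n≡0⇒n≡0 (δ κ a) ab≡0) ,
  count≡0⇒≢ l (m+n≡0⇒n≡0 (δ κ a + δ κ b) abl≡0) , count≡0⇒≢ r (m+n≡0⇒n≡0 (δ κ a + δ κ b + count κ l) ≡0)
  where
  abl≡0 = m+n≡0⇒m≡0 (δ κ a + δ κ b + count κ l) ≡0
  ab≡0  = m+n≡0⇒m≡0 (δ κ a + δ κ b) abl≡0
  δ≡0⇒≢ : ∀ {x} → δ κ x ≡ 0 → x ≢ κ
  δ≡0⇒≢ δ≡0 refl = 1+n≢0 (trans (sym (δ-refl κ)) δ≡0)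

Ancestral-∷ʳ : ∀ {n x} As (t : Tree n) → Ancestral As t → AllNodes (_≢ x) t → Ancestral (As ∷ʳ x) t
Ancestral-∷ʳ As leaf           _                          _                     = tt
Ancestral-∷ʳ {x = x} As (fork a b l r) (a∉As , b∉As , anc-l , anc-r) (a≢x , b≢x , l≢x , r≢x) =
  avoid a∉As a≢x , avoid b∉As b≢x , Ancestral-∷ʳ (a ∷ As) l anc-l l≢x , Ancestral-∷ʳ (b ∷ As) r anc-r r≢x
  where
  avoid : ∀ {c} → c ∉ As → c ≢ x → c ∉ As ∷ʳ x
  avoid c∉As c≢x c∈ with ∈-++⁻ As c∈
  ... | inj₁ c∈As       = c∉As c∈As
  ... | inj₂ (here c≡x) = c≢x c≡x

Realises : ∀ {n} → Tree n → List Entry → Set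
Realises t L = Ancestral [] t × (∀ κ → count κ t ≡ multiplicity L κ)

fork-realises : ∀ {n a b x y L} {l r : Tree n} → Realises l x → Realises r y → a ∉ colours x → b ∉ colours y →
                (∀ κ → δ κ a + δ κ b + multiplicity x κ + multiplicity y κ ≡ multiplicity L κ) →
                Realises (fork a b l r) L
fork-realises {n} {a} {b} {x} {y} {l = l} {r} (anc-l , count-l) (anc-r , count-r) a∉x b∉y split =
  ((λ ()) , (λ ()) , Ancestral-∷ʳ [] l anc-l (avoids count-l a∉x) , Ancestral-∷ʳ [] r anc-r (avoids count-r b∉y)) ,
  λ κ → trans (cong₂ (λ m n → δ κ a + δ κ b + m + n) (count-l κ) (count-r κ)) (split κ)
  where
  avoids : ∀ {c z} {t : Tree n} → (∀ κ → count κ t ≡ multiplicity z κ) → c ∉ colours z → AllNodes (_≢ c) t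
  avoids {t = t} count-t c∉z = count≡0⇒≢ t (trans (count-t _) (∉⇒multiplicity≡0 _ c∉z))

-- Sufficiency

insert : Entry → List Entry → List Entry
insert e []      = [ e ]
insert e (f ∷ L) with quota e ≤? quota f
... | yes _ = e ∷ f ∷ L
... | no  _ = f ∷ insert e L

sort : List Entry → List Entry
sort []      = []
sort (e ∷ L) = insert e (sort L)

insert-↭ : ∀ e L → e ∷ L ↭ insert e L
insert-↭ e []      = ↭-refl
insert-↭ e (f ∷ L) with quota e ≤? quota f
... | yes _ = ↭-refl
... | no  _ = ↭-trans (↭-swap e f ↭-refl) (↭-prep f (insert-↭ e L))

sort-↭ : ∀ L → L ↭ sort L
sort-↭ []      = ↭-refl
sort-↭ (e ∷ L) = ↭-trans (↭-prep e (sort-↭ L)) (insert-↭ e (sort L))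

insert-sorted : ∀ e L → Sorted (quotas L) → Sorted (quotas (insert e L))
insert-sorted e []      []                  = [] ∷ []
insert-sorted e (f ∷ L) (f≤L ∷ sorted) with quota e ≤? quota f
... | yes e≤f = (e≤f ∷ All.map (≤-trans e≤f) f≤L) ∷ f≤L ∷ sorted
... | no  e≰f = All-resp-↭ (Perm.map⁺ quota (insert-↭ e L)) (≰⇒≥ e≰f ∷ f≤L) ∷ insert-sorted e L sorted

sort-sorted : ∀ L → Sorted (quotas (sort L))
sort-sorted []      = []
sort-sorted (e ∷ L) = insert-sorted e (sort L) (sort-sorted L)

record Admissible (n : ℕ) (L : List Entry) : Set where
  field
    length≡   : length L ≡ n
    unique    : Unique (colours L)
    total≡    : sum (quotas L) ≡ size n
    majorised : Majorised n (quotas L)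

  prefix : ∀ k → k ≤ n → size k ≤ sum (take k (quotas L))
  prefix = majorised⇒prefix majorised (trans (List.length-map quota L) length≡)

Admissible-↭ : ∀ {n L M} → L ↭ M → Admissible n L → Admissible n M
Admissible-↭ {n} L↭M adm = record
  { length≡   = trans (sym (Perm.↭-length L↭M)) length≡
  ; unique    = UniqueSetoid.Unique-resp-↭ (↭⇒↭ₛ (Perm.map⁺ colour L↭M)) unique
  ; total≡    = trans (sym (sum-↭ (Perm.map⁺ quota L↭M))) total≡
  ; majorised = λ s → subst (_≤ deficit n s) (sum-↭ (Perm.map⁺ (s ∸_) (Perm.map⁺ quota L↭M))) (majorised s)
  }
  where
  open Admissible adm
  module UniqueSetoid = Data.List.Relation.Binary.Permutation.Setoid.Properties (setoid ℕ)

Realisable : ℕ → List Entry → Set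
Realisable n L = Σ (Tree n) λ t → Realises t L

Realisable-↭ : ∀ {n L M} → L ↭ M → Realisable n L → Realisable n M
Realisable-↭ L↭M (t , anc , count-t) = t , anc , λ κ → trans (count-t κ) (multiplicity-↭ L↭M κ)

Realiser : ℕ → Set
Realiser n = ∀ {L} → Admissible n L → Realisable n L

module Shared {m : ℕ} {e : Entry} {r : List Entry} (realiser : Realiser m)
              (sorted : Sorted (quotas (e ∷ r))) (adm : Admissible (suc m) (e ∷ r)) (c₁≡2 : quota e ≡ 2) where

  open Admissible adm

  κ : ℕ
  κ = colour e

  ∣r∣≡m : length r ≡ m
  ∣r∣≡m = suc-injective length≡

  Σr≡ : sum (quotas r) ≡ size m + size m
  Σr≡ = +-cancelˡ-≡ 2 _ _ (begin
    2 + sum (quotas r)        ≡⟨ cong (_+ sum (quotas r)) (sym c₁≡2) ⟩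
    quota e + sum (quotas r)  ≡⟨ total≡ ⟩
    size (suc m)              ≡⟨ size-suc m ⟩
    2 + 2 * size m            ≡⟨ cong (2 +_) (sym (x+x≡2*x (size m))) ⟩
    2 + (size m + size m)     ∎)
    where open ≡-Reasoning

  double-size≤prefix : ∀ p → p ≤ m → size p + size p ≤ sum (take p (quotas r))
  double-size≤prefix p p≤m = +-cancelˡ-≤ 2 _ _ (begin
    2 + (size p + size p)              ≡⟨ cong (2 +_) (x+x≡2*x (size p)) ⟩
    2 + 2 * size p                     ≡⟨ sym (size-suc p) ⟩
    size (suc p)                       ≤⟨ prefix (suc p) (s≤s p≤m) ⟩
    quota e + sum (take p (quotas r))  ≡⟨ cong (_+ _) c₁≡2 ⟩
    2 + sum (take p (quotas r))        ∎)
    where open ≤-Reasoning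

  majorised-halves : ∀ S → (∀ p → ⌊ sum (take p (quotas r)) /2⌋ ≤ sum (take p (quotas (halves S r)))) →
                     Majorised m (quotas (halves S r))
  majorised-halves S ⌊P/2⌋≤ t =
    deficit-bound p (halves-deficit S r th) (≤-trans (≤⌊/2⌋ (double-size≤prefix p p≤m)) (⌊P/2⌋≤ p)) p≤m
    where
    th = sorted-threshold (AllPairs.tail sorted) (t + t)
    open Threshold th renaming (index to p)
    p≤m = ≤-trans index≤ (≤-reflexive (trans (List.length-map quota r) ∣r∣≡m))

  admissible-halves : ∀ S → sum (quotas (halves S r)) ≡ size m → Majorised m (quotas (halves S r)) → Admissible m (halves S r)
  admissible-halves S total maj = record
    { length≡   = trans (length-halves S r) ∣r∣≡m
    ; unique    = subst Unique (sym (colours-halves S r)) (AllPairs.tail unique)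
    ; total≡    = total
    ; majorised = maj
    }

  realised-x : Realisable m (halves 0 r)
  realised-x = realiser (admissible-halves 0 (trans (sum-halves 0 r) (trans (cong ⌊_/2⌋ Σr≡) (sym (n≡⌊n+n/2⌋ (size m)))))
                                            (majorised-halves 0 (λ p → ≤-reflexive (sym (sum-take-halves 0 p r)))))

  realised-y : Realisable m (halves 1 r)
  realised-y = realiser (admissible-halves 1 (trans (sum-halves 1 r) (trans (cong ⌈_/2⌉ Σr≡) (⌈n+n/2⌉≡n (size m))))
                                            (majorised-halves 1 (λ p → ≤-trans (⌊n/2⌋≤⌈n/2⌉ _) (≤-reflexive (sym (sum-take-halves 1 p r))))))

  κ∉halves : ∀ S → κ ∉ colours (halves S r)
  κ∉halves S = subst (κ ∉_) (sym (colours-halves S r)) (All¬⇒¬Any (AllPairs.head unique))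

  counts : ∀ κ′ → δ κ′ κ + δ κ′ κ + multiplicity (halves 0 r) κ′ + multiplicity (halves 1 r) κ′ ≡ multiplicity (e ∷ r) κ′
  counts κ′ = begin
    δ κ′ κ + δ κ′ κ + X + Y   ≡⟨ regroup (δ κ′ κ) X Y ⟩
    δ κ′ κ * 2 + (X + Y)      ≡⟨ cong₂ (λ c M → δ κ′ κ * c + M) (sym c₁≡2) (multiplicity-halves 0 r κ′) ⟩
    multiplicity (e ∷ r) κ′   ∎
    where
    open ≡-Reasoning
    X = multiplicity (halves 0 r) κ′
    Y = multiplicity (halves 1 r) κ′
    regroup : ∀ d X Y → d + d + X + Y ≡ d * 2 + (X + Y)
    regroup = solve-∀

  realised : Realisable (suc m) (e ∷ r)
  realised = fork κ κ (proj₁ realised-x) (proj₁ realised-y) ,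
             fork-realises {L = e ∷ r} (proj₂ realised-x) (proj₂ realised-y) (κ∉halves 0) (κ∉halves 1) counts

module Split {n : ℕ} {e₁ e₂ e₃ : Entry} {r : List Entry} (realiser : Realiser (2 + n))
             (sorted : Sorted (quotas (e₁ ∷ e₂ ∷ e₃ ∷ r))) (adm : Admissible (3 + n) (e₁ ∷ e₂ ∷ e₃ ∷ r))
             (3≤c₁ : 3 ≤ quota e₁) where

  open Admissible adm

  κ₁ κ₂ κ₃ c₁ c₂ c₃ : ℕ
  κ₁ = colour e₁
  κ₂ = colour e₂
  κ₃ = colour e₃
  c₁ = quota e₁
  c₂ = quota e₂
  c₃ = quota e₃

  c₁≤c₂ : c₁ ≤ c₂
  c₁≤c₂ = All.head (AllPairs.head sorted)

  c₂≤c₃ : c₂ ≤ c₃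
  c₂≤c₃ = All.head (AllPairs.head (AllPairs.tail sorted))

  c₃≤r : All (c₃ ≤_) (quotas r)
  c₃≤r = AllPairs.head (AllPairs.tail (AllPairs.tail sorted))

  sorted-r : Sorted (quotas r)
  sorted-r = AllPairs.tail (AllPairs.tail (AllPairs.tail sorted))

  ∣r∣≡n : length (quotas r) ≡ n
  ∣r∣≡n = trans (List.length-map quota r) (suc-injective (suc-injective (suc-injective length≡)))

  -- The right subtree gets the d = c₂ − c₁ surplus nodes of colour κ₃, as it holds d fewer nodes of
  -- colour κ₁ than the left one holds of colour κ₂.
  A d B q x₃ y₃ : ℕ
  A  = c₁ ∸ 1
  d  = c₂ ∸ c₁
  B  = A + d
  q  = c₃ ∸ d
  x₃ = ⌈ q /2⌉
  y₃ = d + ⌊ q /2⌋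

  c₁≡1+A : c₁ ≡ suc A
  c₁≡1+A = sym (trans (+-comm 1 A) (m∸n+n≡m (≤-trans (s≤s z≤n) 3≤c₁)))

  c₂≡1+B : c₂ ≡ suc B
  c₂≡1+B = begin
    c₂          ≡⟨ sym (m∸n+n≡m c₁≤c₂) ⟩
    d + c₁      ≡⟨ cong (d +_) c₁≡1+A ⟩
    d + suc A   ≡⟨ +-suc d A ⟩
    suc (d + A) ≡⟨ cong suc (+-comm d A) ⟩
    suc B       ∎
    where open ≡-Reasoning

  c₃≡q+d : c₃ ≡ q + d
  c₃≡q+d = sym (m∸n+n≡m (≤-trans (m∸n≤m c₂ c₁) c₂≤c₃))

  c₃≡x₃+y₃ : c₃ ≡ x₃ + y₃
  c₃≡x₃+y₃ = begin
    c₃                         ≡⟨ c₃≡q+d ⟩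
    q + d                      ≡⟨ cong (_+ d) (sym (⌊n/2⌋+⌈n/2⌉≡n q)) ⟩
    ⌊ q /2⌋ + ⌈ q /2⌉ + d      ≡⟨ regroup ⌊ q /2⌋ ⌈ q /2⌉ d ⟩
    ⌈ q /2⌉ + (d + ⌊ q /2⌋)    ∎
    where
    open ≡-Reasoning
    regroup : ∀ a b d → a + b + d ≡ b + (d + a)
    regroup = solve-∀

  first-three : ∀ S → c₁ + (c₂ + (c₃ + S)) ≡ 2 + (B + B + (q + S))
  first-three S = begin
    c₁ + (c₂ + (c₃ + S))                       ≡⟨ cong₂ (λ a b → a + (b + (c₃ + S))) c₁≡1+A c₂≡1+B ⟩
    suc A + (suc B + (c₃ + S))                 ≡⟨ cong (λ c → suc A + (suc B + (c + S))) c₃≡q+d ⟩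
    suc A + (suc (A + d) + ((q + d) + S))      ≡⟨ regroup A d q S ⟩
    2 + ((A + d) + (A + d) + (q + S))          ∎
    where
    open ≡-Reasoning
    regroup : ∀ A d q S → suc A + (suc (A + d) + ((q + d) + S)) ≡ 2 + ((A + d) + (A + d) + (q + S))
    regroup = solve-∀

  total-split : B + B + (q + sum (quotas r)) ≡ size (2 + n) + size (2 + n)
  total-split = +-cancelˡ-≡ 2 _ _ (begin
    2 + (B + B + (q + sum (quotas r)))   ≡⟨ sym (first-three _) ⟩
    c₁ + (c₂ + (c₃ + sum (quotas r)))    ≡⟨ total≡ ⟩
    size (3 + n)                         ≡⟨ size-suc (2 + n) ⟩
    2 + 2 * size (2 + n)                 ≡⟨ cong (2 +_) (sym (x+x≡2*x (size (2 + n)))) ⟩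
    2 + (size (2 + n) + size (2 + n))    ∎)
    where open ≡-Reasoning

  2≤A : 2 ≤ A
  2≤A = ∸-monoˡ-≤ 1 3≤c₁

  5≤c₃ : 5 ≤ c₃
  5≤c₃ = k*m<N≤k*P⇒m<P 3 4 (m+o≡n⇒m≤n 1 refl) (begin
    size 3                     ≤⟨ prefix 3 (s≤s (s≤s (s≤s z≤n))) ⟩
    c₁ + (c₂ + (c₃ + 0))       ≤⟨ +-mono-≤ (≤-trans c₁≤c₂ c₂≤c₃) (+-monoˡ-≤ (c₃ + 0) c₂≤c₃) ⟩
    3 * c₃                     ∎)
    where open ≤-Reasoning

  2≤x₃ : 2 ≤ x₃
  2≤x₃ = ⌈n/2⌉-mono (≤-trans 3≤c₁ c₁≤q)
    where
    c₁≤q : c₁ ≤ q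
    c₁≤q = m+n≤o⇒m≤o∸n c₁ (subst (_≤ c₃) (sym (trans (+-comm c₁ d) (m∸n+n≡m c₁≤c₂))) c₂≤c₃)

  2≤y₃ : 2 ≤ y₃
  2≤y₃ = subst (2 ≤_) (⌊b+b+n/2⌋≡b+⌊n/2⌋ d q) (⌊n/2⌋-mono (begin
    5              ≤⟨ 5≤c₃ ⟩
    c₃             ≡⟨ c₃≡q+d ⟩
    q + d          ≤⟨ m≤n+m (q + d) d ⟩
    d + (q + d)    ≡⟨ regroup d q ⟩
    d + d + q      ∎))
    where
    open ≤-Reasoning
    regroup : ∀ d q → d + (q + d) ≡ d + d + q
    regroup = solve-∀

  module AtIndex (p : ℕ) (p≤n : p ≤ n) where

    P : ℕ
    P = sum (take p (quotas r))

    pc₃≤P : p * c₃ ≤ P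
    pc₃≤P = *≤sum-take p (quotas r) c₃≤r (≤-trans p≤n (≤-reflexive (sym ∣r∣≡n)))

    prefix-3+p : size (3 + p) ≤ c₁ + (c₂ + (c₃ + P))
    prefix-3+p = prefix (3 + p) (s≤s (s≤s (s≤s p≤n)))

    2size[p]≤P : size p + size p ≤ P
    2size[p]≤P = double-size≤ p (p*size≤[3+p]*P p c₁≤c₂ c₂≤c₃ pc₃≤P prefix-3+p)

    2size[1+p]≤4+P : size (1 + p) + size (1 + p) ≤ 2 + 2 + P
    2size[1+p]≤4+P = double-size-suc≤ p (p*size≤[3+p]*P p c₁≤c₂ c₂≤c₃ pc₃≤P prefix-3+p)

    2size[1+p]≤2B+P : size (1 + p) + size (1 + p) ≤ B + B + P
    2size[1+p]≤2B+P = +-cancelʳ-≤ 2 _ _ (begin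
      size (1 + p) + size (1 + p) + 2   ≤⟨ double-size-suc+2≤ p (p*size≤[1+p]*[c₁+c₂+P] {c₁} {c₂} p pc₃≤P prefix-3+p) 6≤c₁+c₂+P ⟩
      c₁ + c₂ + P                       ≤⟨ +-monoˡ-≤ P (+-monoˡ-≤ c₂ c₁≤c₂) ⟩
      c₂ + c₂ + P                       ≡⟨ cong (λ c → c + c + P) c₂≡1+B ⟩
      suc B + suc B + P                 ≡⟨ regroup B P ⟩
      B + B + P + 2                     ∎)
      where
      open ≤-Reasoning
      6≤c₁+c₂+P = ≤-trans (+-mono-≤ 3≤c₁ (≤-trans 3≤c₁ c₁≤c₂)) (m≤m+n (c₁ + c₂) P)
      regroup : ∀ B P → suc B + suc B + P ≡ B + B + P + 2
      regroup = solve-∀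

    2size[2+p]≤2B+q+P : size (2 + p) + size (2 + p) ≤ B + B + (q + P)
    2size[2+p]≤2B+q+P = +-cancelˡ-≤ 2 _ _ (begin
      2 + (size (2 + p) + size (2 + p))   ≡⟨ cong (2 +_) (x+x≡2*x (size (2 + p))) ⟩
      2 + 2 * size (2 + p)                ≡⟨ sym (size-suc (2 + p)) ⟩
      size (3 + p)                        ≤⟨ prefix-3+p ⟩
      c₁ + (c₂ + (c₃ + P))                ≡⟨ first-three P ⟩
      2 + (B + B + (q + P))               ∎)
      where open ≤-Reasoning

  module AtThreshold (t : ℕ) where

    th : Threshold (t + t) (quotas r)
    th = sorted-threshold sorted-r (t + t)

    open Threshold th public

    p≤n : index ≤ n
    p≤n = ≤-trans index≤ (≤-reflexive ∣r∣≡n)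
    open AtIndex index p≤n public

    split₀ : deficitOf (quotas (halves 0 r)) t + ⌊ P /2⌋ ≡ index * t
    split₀ = subst (λ S → deficitOf (quotas (halves 0 r)) t + S ≡ index * t) (sum-take-halves 0 index r) (halves-deficit {t} 0 r th)

    split₁ : deficitOf (quotas (halves 1 r)) t + ⌈ P /2⌉ ≡ index * t
    split₁ = subst (λ S → deficitOf (quotas (halves 1 r)) t + S ≡ index * t) (sum-take-halves 1 index r) (halves-deficit {t} 1 r th)

  majorised-x : Majorised (2 + n) (quotas ((κ₂ , B) ∷ (κ₃ , x₃) ∷ halves 0 r))
  majorised-x t = deficit-bound₂ B x₃ split₀ (s≤s (s≤s p≤n))
    (≤⌊/2⌋ 2size[p]≤P)
    (≤b+⌊n/2⌋ B P 2size[1+p]≤2B+P)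
    (≤-trans (≤b+⌊n/2⌋ 2 P 2size[1+p]≤4+P) (+-monoˡ-≤ ⌊ P /2⌋ 2≤x₃))
    (≤-trans (≤b+⌊n/2⌋ B (q + P) 2size[2+p]≤2B+q+P) (+-monoʳ-≤ B (⌊a+b/2⌋≤⌈a/2⌉+⌊b/2⌋ q P)))
    where open AtThreshold t

  majorised-y : Majorised (2 + n) (quotas ((κ₁ , A) ∷ (κ₃ , y₃) ∷ halves 1 r))
  majorised-y t = deficit-bound₂ A y₃ split₁ (s≤s (s≤s p≤n))
    (≤-trans (≤⌊/2⌋ 2size[p]≤P) (⌊n/2⌋≤⌈n/2⌉ P))
    (≤-trans (≤b+⌊n/2⌋ 2 P 2size[1+p]≤4+P) (+-mono-≤ 2≤A (⌊n/2⌋≤⌈n/2⌉ P)))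
    (≤-trans (≤b+⌊n/2⌋ 2 P 2size[1+p]≤4+P) (+-mono-≤ 2≤y₃ (⌊n/2⌋≤⌈n/2⌉ P)))
    (≤-trans (≤b+⌊n/2⌋ B (q + P) 2size[2+p]≤2B+q+P) (≤-trans (+-monoʳ-≤ B (⌊a+b/2⌋≤⌊a/2⌋+⌈b/2⌉ q P)) (≤-reflexive (regroup A d ⌊ q /2⌋ ⌈ P /2⌉))))
    where
    open AtThreshold t
    regroup : ∀ A d f c → A + d + (f + c) ≡ A + (d + f + c)
    regroup = solve-∀

  B+B+q+Σr≡ : B + B + q + sum (quotas r) ≡ size (2 + n) + size (2 + n)
  B+B+q+Σr≡ = trans (+-assoc (B + B) q _) total-split

  total-x : sum (quotas ((κ₂ , B) ∷ (κ₃ , x₃) ∷ halves 0 r)) ≡ size (2 + n)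
  total-x = begin
    B + (x₃ + sum (quotas (halves 0 r)))   ≡⟨ cong (λ s → B + (x₃ + s)) (sum-halves 0 r) ⟩
    B + (⌈ q /2⌉ + ⌊ Σr /2⌋)              ≡⟨ sym (+-assoc B ⌈ q /2⌉ ⌊ Σr /2⌋) ⟩
    B + ⌈ q /2⌉ + ⌊ Σr /2⌋                ≡⟨ cong (_+ ⌊ Σr /2⌋) (sym (⌈b+b+n/2⌉≡b+⌈n/2⌉ B q)) ⟩
    ⌈ B + B + q /2⌉ + ⌊ Σr /2⌋            ≡⟨ ⌈a/2⌉+⌊b/2⌋≡half (B + B + q) Σr B+B+q+Σr≡ ⟩
    size (2 + n)                           ∎
    where
    open ≡-Reasoning
    Σr = sum (quotas r)

  total-y : sum (quotas ((κ₁ , A) ∷ (κ₃ , y₃) ∷ halves 1 r)) ≡ size (2 + n)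
  total-y = begin
    A + (y₃ + sum (quotas (halves 1 r)))   ≡⟨ cong (λ s → A + (y₃ + s)) (sum-halves 1 r) ⟩
    A + ((d + ⌊ q /2⌋) + ⌈ Σr /2⌉)        ≡⟨ regroup A d ⌊ q /2⌋ ⌈ Σr /2⌉ ⟩
    B + ⌊ q /2⌋ + ⌈ Σr /2⌉                ≡⟨ cong (_+ ⌈ Σr /2⌉) (sym (⌊b+b+n/2⌋≡b+⌊n/2⌋ B q)) ⟩
    ⌊ B + B + q /2⌋ + ⌈ Σr /2⌉            ≡⟨ ⌊a/2⌋+⌈b/2⌉≡half (B + B + q) Σr B+B+q+Σr≡ ⟩
    size (2 + n)                           ∎
    where
    open ≡-Reasoning
    Σr = sum (quotas r)
    regroup : ∀ A d f c → A + ((d + f) + c) ≡ A + d + f + c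
    regroup = solve-∀

  κ₁-fresh : All (κ₁ ≢_) (κ₂ ∷ κ₃ ∷ colours r)
  κ₁-fresh = AllPairs.head unique

  κ₂-fresh : All (κ₂ ≢_) (κ₃ ∷ colours r)
  κ₂-fresh = AllPairs.head (AllPairs.tail unique)

  unique-κ₃r : Unique (κ₃ ∷ colours r)
  unique-κ₃r = AllPairs.tail (AllPairs.tail unique)

  with-halves : ∀ S {P : List ℕ → Set} {a b} → P (a ∷ b ∷ colours r) → P (a ∷ b ∷ colours (halves S r))
  with-halves S {P} {a} {b} = subst (λ cs → P (a ∷ b ∷ cs)) (sym (colours-halves S r))

  admissible-x : Admissible (2 + n) ((κ₂ , B) ∷ (κ₃ , x₃) ∷ halves 0 r)
  admissible-x = record
    { length≡   = cong (2 +_) (trans (length-halves 0 r) (trans (sym (List.length-map quota r)) ∣r∣≡n))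
    ; unique    = with-halves 0 {Unique} (κ₂-fresh ∷ unique-κ₃r)
    ; total≡    = total-x
    ; majorised = majorised-x
    }

  admissible-y : Admissible (2 + n) ((κ₁ , A) ∷ (κ₃ , y₃) ∷ halves 1 r)
  admissible-y = record
    { length≡   = cong (2 +_) (trans (length-halves 1 r) (trans (sym (List.length-map quota r)) ∣r∣≡n))
    ; unique    = with-halves 1 {Unique} (All.tail κ₁-fresh ∷ unique-κ₃r)
    ; total≡    = total-y
    ; majorised = majorised-y
    }

  counts : ∀ κ → δ κ κ₁ + δ κ κ₂ + multiplicity ((κ₂ , B) ∷ (κ₃ , x₃) ∷ halves 0 r) κ
                                  + multiplicity ((κ₁ , A) ∷ (κ₃ , y₃) ∷ halves 1 r) κ
                 ≡ multiplicity (e₁ ∷ e₂ ∷ e₃ ∷ r) κ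
  counts κ = begin
    d₁ + d₂ + (d₂ * B + (d₃ * x₃ + X)) + (d₁ * A + (d₃ * y₃ + Y))   ≡⟨ regroup d₁ d₂ d₃ A B x₃ y₃ X Y ⟩
    d₁ * suc A + (d₂ * suc B + (d₃ * (x₃ + y₃) + (X + Y)))
      ≡⟨ cong₂ (λ a b → d₁ * a + (d₂ * b + (d₃ * (x₃ + y₃) + (X + Y)))) (sym c₁≡1+A) (sym c₂≡1+B) ⟩
    d₁ * c₁ + (d₂ * c₂ + (d₃ * (x₃ + y₃) + (X + Y)))
      ≡⟨ cong₂ (λ c M → d₁ * c₁ + (d₂ * c₂ + (d₃ * c + M))) (sym c₃≡x₃+y₃) (multiplicity-halves 0 r κ) ⟩
    d₁ * c₁ + (d₂ * c₂ + (d₃ * c₃ + multiplicity r κ))             ∎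
    where
    open ≡-Reasoning
    d₁ = δ κ κ₁
    d₂ = δ κ κ₂
    d₃ = δ κ κ₃
    X = multiplicity (halves 0 r) κ
    Y = multiplicity (halves 1 r) κ
    regroup : ∀ d₁ d₂ d₃ A B x y X Y → d₁ + d₂ + (d₂ * B + (d₃ * x + X)) + (d₁ * A + (d₃ * y + Y))
                                        ≡ d₁ * suc A + (d₂ * suc B + (d₃ * (x + y) + (X + Y)))
    regroup = solve-∀

  realised : Realisable (3 + n) (e₁ ∷ e₂ ∷ e₃ ∷ r)
  realised = fork κ₁ κ₂ (proj₁ left) (proj₁ right) ,
             fork-realises {L = e₁ ∷ e₂ ∷ e₃ ∷ r} (proj₂ left) (proj₂ right)
               (with-halves 0 {_∉_ κ₁} (All¬⇒¬Any κ₁-fresh))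
               (with-halves 1 {_∉_ κ₂} (All¬⇒¬Any (≢-sym (All.head κ₁-fresh) ∷ κ₂-fresh)))
               counts
    where
    left  = realiser admissible-x
    right = realiser admissible-y

admissible-single : ∀ κ → Admissible 1 [ (κ , 2) ]
admissible-single κ = record
  { length≡ = refl ; unique = [] ∷ [] ; total≡ = refl ; majorised = λ s → ≤-reflexive (+-comm (s ∸ 2) 0) }

realise-pair : ∀ {e₁ e₂} → Realiser 1 → Sorted (quotas (e₁ ∷ e₂ ∷ [])) → Admissible 2 (e₁ ∷ e₂ ∷ []) → 3 ≤ quota e₁ →
               Realisable 2 (e₁ ∷ e₂ ∷ [])
realise-pair {e₁} {e₂} realiser ((c₁≤c₂ ∷ []) ∷ _) adm 3≤c₁ =
  fork κ₁ κ₂ (proj₁ left) (proj₁ right) ,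
  fork-realises {L = e₁ ∷ e₂ ∷ []} (proj₂ left) (proj₂ right) (All¬⇒¬Any (κ₁≢κ₂ ∷ [])) (All¬⇒¬Any (≢-sym κ₁≢κ₂ ∷ [])) counts
  where
  open Admissible adm
  κ₁ = colour e₁
  κ₂ = colour e₂
  κ₁≢κ₂ = All.head (AllPairs.head unique)
  left  = realiser (admissible-single κ₂)
  right = realiser (admissible-single κ₁)
  c₁≡3 : quota e₁ ≡ 3
  c₁≡3 = ≤-antisym (≤⌊/2⌋ (≤-trans (+-monoʳ-≤ (quota e₁) (≤-trans c₁≤c₂ (m≤m+n _ 0))) (≤-reflexive total≡))) 3≤c₁
  c₂≡3 : quota e₂ ≡ 3
  c₂≡3 = +-cancelˡ-≡ 3 _ _ (trans (cong (_+ quota e₂) (sym c₁≡3)) (trans (cong (quota e₁ +_) (sym (+-identityʳ _))) total≡))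
  counts : ∀ κ → δ κ κ₁ + δ κ κ₂ + multiplicity [ (κ₂ , 2) ] κ + multiplicity [ (κ₁ , 2) ] κ ≡ multiplicity (e₁ ∷ e₂ ∷ []) κ
  counts κ = trans (regroup (δ κ κ₁) (δ κ κ₂))
                   (cong₂ (λ a b → δ κ κ₁ * a + (δ κ κ₂ * b + 0)) (sym c₁≡3) (sym c₂≡3))
    where
    regroup : ∀ d₁ d₂ → d₁ + d₂ + (d₂ * 2 + 0) + (d₁ * 2 + 0) ≡ d₁ * 3 + (d₂ * 3 + 0)
    regroup = solve-∀

realise-≥3 : ∀ {m e} rest → Realiser m → Sorted (quotas (e ∷ rest)) → Admissible (suc m) (e ∷ rest) → 3 ≤ quota e →
             Realisable (suc m) (e ∷ rest)
realise-≥3 {e = e} []          realiser sorted adm 3≤c₁ with refl ← Admissible.length≡ adm =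
  ⊥-elim (<⇒≢ 3≤c₁ (sym (trans (sym (+-identityʳ (quota e))) (Admissible.total≡ adm))))
realise-≥3         (_ ∷ [])     realiser sorted adm 3≤c₁ with refl ← Admissible.length≡ adm =
  realise-pair realiser sorted adm 3≤c₁
realise-≥3         (_ ∷ _ ∷ _)  realiser sorted adm 3≤c₁ with refl ← Admissible.length≡ adm =
  Split.realised realiser sorted adm 3≤c₁

realise-sorted : ∀ {m L} → Realiser m → Sorted (quotas L) → Admissible (suc m) L → Realisable (suc m) L
realise-sorted {L = []}    _        _      adm = ⊥-elim (0≢1+n (Admissible.length≡ adm))
realise-sorted {L = e ∷ rest} realiser sorted adm with quota e ≟ 2
... | yes c₁≡2 = Shared.realised realiser sorted adm c₁≡2
... | no  c₁≢2 = realise-≥3 rest realiser sorted adm (≤∧≢⇒< 2≤c₁ (≢-sym c₁≢2))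
  where
  2≤c₁ : 2 ≤ quota e
  2≤c₁ = subst (2 ≤_) (+-identityʳ (quota e)) (Admissible.prefix adm 1 (s≤s z≤n))

realise : ∀ n → Realiser n
realise zero    {[]}    _   = leaf , tt , λ _ → refl
realise zero    {_ ∷ _} adm = ⊥-elim (1+n≢0 (Admissible.length≡ adm))
realise (suc m) {L}     adm =
  Realisable-↭ (↭-sym (sort-↭ L)) (realise-sorted (realise m) (sort-sorted L) (Admissible-↭ (sort-↭ L) adm))

palette : (ℕ → ℕ) → ℕ → List Entry
palette c h = map (λ i → i , c i) (rangeFrom 1 h)

colours-palette : ∀ c h → colours (palette c h) ≡ rangeFrom 1 h
colours-palette c h = trans (sym (List.map-∘ (rangeFrom 1 h))) (List.map-id (rangeFrom 1 h))

quotas-palette : ∀ c h → quotas (palette c h) ≡ map c (rangeFrom 1 h)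
quotas-palette c h = sym (List.map-∘ (rangeFrom 1 h))

multiplicity-∈ : ∀ {κ v} L → Unique (colours L) → (κ , v) ∈ L → multiplicity L κ ≡ v
multiplicity-∈ {κ} {v} ((κ , v) ∷ L) (κ∉L ∷ _) (here refl) =
  trans (cong₂ _+_ (trans (cong (_* v) (δ-refl κ)) (+-identityʳ v)) (∉⇒multiplicity≡0 L (All¬⇒¬Any κ∉L))) (+-identityʳ v)
multiplicity-∈ {κ} (e ∷ L) (e∉L ∷ unique) (there κv∈L) =
  cong₂ _+_ (cong (_* quota e) (δ-≢ κ≢e)) (multiplicity-∈ L unique κv∈L)
  where
  κ≢e : κ ≢ colour e
  κ≢e refl = All¬⇒¬Any e∉L (∈-map⁺ colour κv∈L)

sorted-palette : ∀ h c → IsColorSequence h c → Sorted (map c (rangeFrom 1 h))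
sorted-palette h c (_ , mono) = Linked⇒AllPairs ≤-trans (linked 1 h (s≤s z≤n) ≤-refl)
  where
  linked : ∀ a k → 1 ≤ a → a + k ≤ suc h → Linked _≤_ (map c (rangeFrom a k))
  linked a zero          _   _   = []
  linked a (suc zero)    _   _   = [-]
  linked a (suc (suc k)) 1≤a a+k≤ =
    mono a 1≤a (≤-trans (m<m+n a (s≤s z≤n)) (≤-pred (≤-trans (≤-reflexive (sym (+-suc a (suc k)))) a+k≤)))
    ∷ linked (suc a) (suc k) (s≤s z≤n) (≤-trans (≤-reflexive (sym (+-suc a (suc k)))) a+k≤)

admissible-palette : ∀ h c → IsColorSequence h c → IsFeasible h c → Admissible h (palette c h)
admissible-palette h c seq (C1 , C2) = record
  { length≡   = trans (List.length-map _ (rangeFrom 1 h)) (length-rangeFrom 1 h)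
  ; unique    = subst Unique (sym (colours-palette c h)) (unique-rangeFrom 1 h)
  ; total≡    = trans (cong sum (quotas-palette c h)) (trans (sum-rangeFrom c h) C2)
  ; majorised = subst (λ vs → Majorised h vs) (sym (quotas-palette c h))
                  (subst (λ n → Majorised n (map c (rangeFrom 1 h))) ∣cs∣≡h (prefix⇒majorised (sorted-palette h c seq) prefix))
  }
  where
  ∣cs∣≡h = trans (List.length-map c (rangeFrom 1 h)) (length-rangeFrom 1 h)
  prefix : ∀ k → k ≤ length (map c (rangeFrom 1 h)) → size k ≤ sum (take k (map c (rangeFrom 1 h)))
  prefix zero    _ = z≤n
  prefix (suc k) k<∣cs∣ = subst (size (suc k) ≤_) (sym sum-take≡) (C1 (suc k) (s≤s z≤n) k<h)
    where
    k<h = ≤-trans k<∣cs∣ (≤-reflexive ∣cs∣≡h)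
    sum-take≡ : sum (take (suc k) (map c (rangeFrom 1 h))) ≡ sumTo (suc k) c
    sum-take≡ = trans (cong sum (trans (List.take-map (suc k) (rangeFrom 1 h)) (cong (map c) (take-rangeFrom 1 k<h))))
                      (sum-rangeFrom c (suc k))

InRange : ℕ → ℕ → Set
InRange h a = 1 ≤ a × a ≤ h

AllNodes-by-exclusion : ∀ {n} {P : ℕ → Set} → Decidable P → (t : Tree n) → (∀ a → ¬ P a → AllNodes (_≢ a) t) → AllNodes P t
AllNodes-by-exclusion P? leaf           _     = tt
AllNodes-by-exclusion {P = P} P? (fork a b l r) avoid =
  decide a (proj₁ ∘ avoid a) , decide b (proj₁ ∘ proj₂ ∘ avoid b) ,
  AllNodes-by-exclusion P? l (λ x ¬Px → proj₁ (proj₂ (proj₂ (avoid x ¬Px)))) ,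
  AllNodes-by-exclusion P? r (λ x ¬Px → proj₂ (proj₂ (proj₂ (avoid x ¬Px))))
  where
  decide : ∀ x → (¬ P x → x ≢ x) → P x
  decide x x≢x with P? x
  ... | yes Px = Px
  ... | no ¬Px = ⊥-elim (x≢x ¬Px refl)

realise-palette : ∀ h c → IsColorSequence h c → IsFeasible h c →
                  Σ (Tree h) λ t → Ancestral [] t × AllNodes (InRange h) t × (∀ i → 1 ≤ i → i ≤ h → count i t ≡ c i)
realise-palette h c seq feasible = t , ancestral , AllNodes-by-exclusion in-range? t outside , counts
  where
  realised = realise h (admissible-palette h c seq feasible)
  t = proj₁ realised
  ancestral = proj₁ (proj₂ realised)
  count-t = proj₂ (proj₂ realised)
  in-range? : Decidable (InRange h)
  in-range? a = (1 ≤? a) ×-dec (a ≤? h)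
  unique-palette : Unique (colours (palette c h))
  unique-palette = Admissible.unique (admissible-palette h c seq feasible)
  outside : ∀ a → ¬ InRange h a → AllNodes (_≢ a) t
  outside a ¬in = count≡0⇒≢ t (trans (count-t a) (∉⇒multiplicity≡0 (palette c h) a∉))
    where
    a∉ : a ∉ colours (palette c h)
    a∉ a∈ with ∈-rangeFrom⁻ 1 h (subst (a ∈_) (colours-palette c h) a∈)
    ... | 1≤a , a<1+h = ¬in (1≤a , ≤-pred a<1+h)
  counts : ∀ i → 1 ≤ i → i ≤ h → count i t ≡ c i
  counts i 1≤i i≤h = trans (count-t i) (multiplicity-∈ (palette c h) unique-palette (∈-map⁺ _ (∈-rangeFrom⁺ 1 h 1≤i (s≤s i≤h))))

-- Necessity

-- The indicator of 1 ≤ a ≤ ℓ, written as a sum so that lowCount ℓ t = Σᵢ count i t splits over nodes.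
isLow : ℕ → ℕ → ℕ
isLow ℓ a = sumTo ℓ (λ i → δ i a)

isLow-≡0 : ∀ ℓ {a} → ℓ < a → isLow ℓ a ≡ 0
isLow-≡0 zero    _   = refl
isLow-≡0 (suc ℓ) 1+ℓ<a = cong₂ _+_ (isLow-≡0 ℓ (<-trans (n<1+n ℓ) 1+ℓ<a)) (δ-≢ (<⇒≢ 1+ℓ<a))

isLow-≡1 : ∀ ℓ {a} → 1 ≤ a → a ≤ ℓ → isLow ℓ a ≡ 1
isLow-≡1 zero    (s≤s _) ()
isLow-≡1 (suc ℓ) {a} 1≤a a≤1+ℓ with a ≟ suc ℓ
... | yes refl = cong₂ _+_ (isLow-≡0 ℓ ≤-refl) (δ-refl (suc ℓ))
... | no  a≢1+ℓ = trans (cong₂ _+_ (isLow-≡1 ℓ 1≤a (≤-pred (≤∧≢⇒< a≤1+ℓ a≢1+ℓ))) (δ-≢ (≢-sym a≢1+ℓ))) refl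

isLow≤1 : ∀ ℓ a → isLow ℓ a ≤ 1
isLow≤1 zero    a = z≤n
isLow≤1 (suc ℓ) a with a ≟ suc ℓ
... | yes refl = ≤-reflexive (cong₂ _+_ (isLow-≡0 ℓ ≤-refl) (δ-refl (suc ℓ)))
... | no  a≢1+ℓ = ≤-trans (≤-reflexive (trans (cong (isLow ℓ a +_) (δ-≢ (≢-sym a≢1+ℓ))) (+-identityʳ _))) (isLow≤1 ℓ a)

lowCount : ∀ {n} → ℕ → Tree n → ℕ
lowCount ℓ t = sumTo ℓ (λ i → count i t)

lowCount-fork : ∀ {n} ℓ a b (l r : Tree n) → lowCount ℓ (fork a b l r) ≡ isLow ℓ a + isLow ℓ b + lowCount ℓ l + lowCount ℓ r
lowCount-fork ℓ a b l r = begin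
  sumTo ℓ (λ i → δ i a + δ i b + count i l + count i r)     ≡⟨ sumTo-+ ℓ _ _ ⟩
  sumTo ℓ (λ i → δ i a + δ i b + count i l) + lowCount ℓ r   ≡⟨ cong (_+ lowCount ℓ r) (sumTo-+ ℓ _ _) ⟩
  sumTo ℓ (λ i → δ i a + δ i b) + lowCount ℓ l + lowCount ℓ r ≡⟨ cong (λ s → s + lowCount ℓ l + lowCount ℓ r) (sumTo-+ ℓ _ _) ⟩
  isLow ℓ a + isLow ℓ b + lowCount ℓ l + lowCount ℓ r       ∎
  where open ≡-Reasoning

lowCount-all : ∀ {n} ℓ (t : Tree n) → AllNodes (InRange ℓ) t → lowCount ℓ t ≡ size n
lowCount-all ℓ leaf                         _                                             = sumTo-zero ℓ
lowCount-all ℓ (fork {n} a b l r) ((1≤a , a≤ℓ) , (1≤b , b≤ℓ) , in-l , in-r) = begin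
  lowCount ℓ (fork a b l r)                              ≡⟨ lowCount-fork ℓ a b l r ⟩
  isLow ℓ a + isLow ℓ b + lowCount ℓ l + lowCount ℓ r
    ≡⟨ cong₂ (λ x y → x + y + lowCount ℓ l + lowCount ℓ r) (isLow-≡1 ℓ 1≤a a≤ℓ) (isLow-≡1 ℓ 1≤b b≤ℓ) ⟩
  2 + lowCount ℓ l + lowCount ℓ r                        ≡⟨ cong₂ (λ x y → 2 + x + y) (lowCount-all ℓ l in-l) (lowCount-all ℓ r in-r) ⟩
  2 + size n + size n                                    ≡⟨ regroup (size n) ⟩
  2 + 2 * size n                                         ≡⟨ sym (size-suc n) ⟩
  size (suc n)                                           ∎
  where
  open ≡-Reasoning
  regroup : ∀ g → 2 + g + g ≡ 2 + 2 * g
  regroup = solve-∀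

lowList : ℕ → List ℕ → ℕ
lowList ℓ As = sum (map (isLow ℓ) As)

length≤lowList+high : ∀ ℓ {As} → All (1 ≤_) As → length As ≤ lowList ℓ As + length (filter (ℓ <?_) As)
length≤lowList+high ℓ {[]}     []           = z≤n
length≤lowList+high ℓ {a ∷ As} (1≤a ∷ 1≤As) with ℓ <? a
... | yes ℓ<a = begin
  suc (length As)                                            ≤⟨ s≤s (length≤lowList+high ℓ 1≤As) ⟩
  suc (lowList ℓ As + length (filter (ℓ <?_) As))            ≡⟨ sym (+-suc _ _) ⟩
  lowList ℓ As + suc (length (filter (ℓ <?_) As))            ≤⟨ m≤n+m _ (isLow ℓ a) ⟩
  isLow ℓ a + (lowList ℓ As + suc (length (filter (ℓ <?_) As))) ≡⟨ sym (+-assoc (isLow ℓ a) _ _) ⟩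
  isLow ℓ a + lowList ℓ As + suc (length (filter (ℓ <?_) As))
    ≡⟨ cong (λ zs → isLow ℓ a + lowList ℓ As + length zs) (sym (List.filter-accept (ℓ <?_) ℓ<a)) ⟩
  isLow ℓ a + lowList ℓ As + length (filter (ℓ <?_) (a ∷ As)) ∎
  where open ≤-Reasoning
... | no  ℓ≮a = begin
  suc (length As)                                            ≤⟨ s≤s (length≤lowList+high ℓ 1≤As) ⟩
  suc (lowList ℓ As + length (filter (ℓ <?_) As))            ≡⟨ cong (λ e → e + lowList ℓ As + _) (sym (isLow-≡1 ℓ 1≤a (≮⇒≥ ℓ≮a))) ⟩
  isLow ℓ a + lowList ℓ As + length (filter (ℓ <?_) As)
    ≡⟨ cong (λ zs → isLow ℓ a + lowList ℓ As + length zs) (sym (List.filter-reject (ℓ <?_) ℓ≮a)) ⟩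
  isLow ℓ a + lowList ℓ As + length (filter (ℓ <?_) (a ∷ As)) ∎
  where open ≤-Reasoning

ℓ≤lowList : ∀ {h ℓ As} → ℓ ≤ h → Unique As → All (InRange h) As → length As ≡ h → ℓ ≤ lowList ℓ As
ℓ≤lowList {h} {ℓ} {As} ℓ≤h unique in-range refl = begin
  ℓ                                  ≡⟨ sym (m∸[m∸n]≡n ℓ≤h) ⟩
  h ∸ (h ∸ ℓ)                        ≤⟨ m≤n+o⇒m∸n≤o h (h ∸ ℓ) (subst (h ≤_) (+-comm (lowList ℓ As) (h ∸ ℓ)) h≤) ⟩
  lowList ℓ As                       ∎
  where
  open ≤-Reasoning
  highs = filter (ℓ <?_) As
  h≤ : h ≤ lowList ℓ As + (h ∸ ℓ)
  h≤ = ≤-trans (length≤lowList+high ℓ (All.map proj₁ in-range))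
               (+-monoʳ-≤ (lowList ℓ As) (pigeonhole ℓ h (Unique.filter⁺ (ℓ <?_) unique)
                 (All.zipWith (λ (ℓ<a , a≤h) → ℓ<a , a≤h) (all-filter (ℓ <?_) As , filter⁺ (ℓ <?_) (All.map proj₂ in-range)))))

size-split : ∀ k {e₁ e₂} → e₁ ≤ 1 → e₂ ≤ 1 → size k ≤ (e₁ + size (k ∸ e₁)) + (e₂ + size (k ∸ e₂))
size-split k       {zero}           {e₂}       _       _       = m≤m+n (size k) _
size-split k       {suc zero}       {zero}     _       _       = m≤n+m (size k) _
size-split zero    {suc zero}       {suc zero} _       _       = z≤n
size-split (suc k) {suc zero}       {suc zero} _       _       = ≤-reflexive (trans (size-suc k) (regroup (size k)))
  where
  regroup : ∀ g → 2 + 2 * g ≡ (1 + g) + (1 + g)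
  regroup = solve-∀
size-split k       {suc (suc _)}    {_}        (s≤s ()) _
size-split k       {suc zero}       {suc (suc _)} _    (s≤s ())

module LowerBound (h ℓ : ℕ) (ℓ≤h : ℓ ≤ h) where

  lowCount-≥ : ∀ {n} (t : Tree n) As → Ancestral As t → AllNodes (InRange h) t → All (InRange h) As → Unique As →
               length As + n ≡ h → size (ℓ ∸ lowList ℓ As) ≤ lowCount ℓ t
  lowCount-≥ leaf As _ _ in-range unique ∣As∣+0≡h =
    ≤-reflexive (trans (cong size (m≤n⇒m∸n≡0 (ℓ≤lowList ℓ≤h unique in-range (trans (sym (+-identityʳ _)) ∣As∣+0≡h))))
                       (sym (sumTo-zero ℓ)))
  lowCount-≥ {suc n} (fork a b l r) As (a∉As , b∉As , anc-l , anc-r) (a-in , b-in , l-in , r-in) in-range unique ∣As∣+n≡h = begin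
    size k                                                          ≤⟨ size-split k (isLow≤1 ℓ a) (isLow≤1 ℓ b) ⟩
    (isLow ℓ a + size (k ∸ isLow ℓ a)) + (isLow ℓ b + size (k ∸ isLow ℓ b))
      ≤⟨ +-mono-≤ (child a l a∉As anc-l a-in l-in) (child b r b∉As anc-r b-in r-in) ⟩
    (isLow ℓ a + lowCount ℓ l) + (isLow ℓ b + lowCount ℓ r)         ≡⟨ regroup (isLow ℓ a) (lowCount ℓ l) (isLow ℓ b) (lowCount ℓ r) ⟩
    isLow ℓ a + isLow ℓ b + lowCount ℓ l + lowCount ℓ r             ≡⟨ sym (lowCount-fork ℓ a b l r) ⟩
    lowCount ℓ (fork a b l r)                                       ∎
    where
    open ≤-Reasoning
    k = ℓ ∸ lowList ℓ As
    regroup : ∀ a l b r → (a + l) + (b + r) ≡ a + b + l + r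
    regroup = solve-∀
    child : ∀ x (s : Tree n) → x ∉ As → Ancestral (x ∷ As) s → InRange h x → AllNodes (InRange h) s →
            isLow ℓ x + size (k ∸ isLow ℓ x) ≤ isLow ℓ x + lowCount ℓ s
    child x s x∉As anc-s x-in s-in = +-monoʳ-≤ (isLow ℓ x) (subst (λ m → size m ≤ lowCount ℓ s) k∸≡
      (lowCount-≥ s (x ∷ As) anc-s s-in (x-in ∷ in-range) (¬Any⇒All¬ As x∉As ∷ unique) (trans (sym (+-suc _ n)) ∣As∣+n≡h)))
      where
      k∸≡ : ℓ ∸ (isLow ℓ x + lowList ℓ As) ≡ k ∸ isLow ℓ x
      k∸≡ = trans (cong (ℓ ∸_) (+-comm (isLow ℓ x) _)) (sym (∸-+-assoc ℓ (lowList ℓ As) (isLow ℓ x)))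

feasible-tree : ∀ h c (t : Tree h) → Ancestral [] t → AllNodes (InRange h) t → (∀ i → 1 ≤ i → i ≤ h → count i t ≡ c i) →
                IsFeasible h c
feasible-tree h c t ancestral in-range counts = C1 , C2
  where
  sumTo-c : ∀ ℓ → ℓ ≤ h → sumTo ℓ c ≡ lowCount ℓ t
  sumTo-c ℓ ℓ≤h = sumTo-cong ℓ (λ i 1≤i i≤ℓ → sym (counts i 1≤i (≤-trans i≤ℓ ℓ≤h)))
  C1 : ∀ ℓ → 1 ≤ ℓ → ℓ ≤ h → sumTo ℓ (2 ^_) ≤ sumTo ℓ c
  C1 ℓ _ ℓ≤h = subst (size ℓ ≤_) (sym (sumTo-c ℓ ℓ≤h)) (LowerBound.lowCount-≥ h ℓ ℓ≤h t [] ancestral in-range [] [] refl)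
  C2 : sumTo h c ≡ sumTo h (2 ^_)
  C2 = trans (sumTo-c h ≤-refl) (lowCount-all h t in-range)

-- Heap numbering of T(h)

parentIter-suc : ∀ k w → parentIter (suc k) w ≡ ⌊ parentIter k w /2⌋
parentIter-suc k w = /2≡⌊/2⌋ (parentIter k w)

parentIter-+ : ∀ j k w → parentIter (j + k) w ≡ parentIter j (parentIter k w)
parentIter-+ zero    k w = refl
parentIter-+ (suc j) k w = cong (_/ 2) (parentIter-+ j k w)

parentIter-≤ : ∀ k w → parentIter k w ≤ w
parentIter-≤ zero    w = ≤-refl
parentIter-≤ (suc k) w = ≤-trans (≤-reflexive (parentIter-suc k w)) (≤-trans (⌊n/2⌋≤n _) (parentIter-≤ k w))

parentIter-< : ∀ k {w} → 1 ≤ k → 1 ≤ w → parentIter k w < w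
parentIter-< (suc k) {suc w} _ _ = begin-strict
  parentIter (suc k) (suc w)   ≡⟨ parentIter-suc k (suc w) ⟩
  ⌊ parentIter k (suc w) /2⌋   ≤⟨ ⌊n/2⌋-mono (parentIter-≤ k (suc w)) ⟩
  ⌊ suc w /2⌋                  <⟨ ⌊n/2⌋<n w ⟩
  suc w                        ∎
  where open ≤-Reasoning

parentIter-shrinks : ∀ {a b} w → a < b → 1 ≤ parentIter a w → parentIter b w < parentIter a w
parentIter-shrinks {a} {b} w a<b 1≤ =
  subst (_< parentIter a w) (sym (trans (cong (λ c → parentIter c w) (sym (m∸n+n≡m (<⇒≤ a<b)))) (parentIter-+ (b ∸ a) a w)))
        (parentIter-< (b ∸ a) (m<n⇒0<n∸m a<b) 1≤)

depth-unique : ∀ a b {w} → 1 ≤ parentIter a w → parentIter a w ≡ parentIter b w → a ≡ b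
depth-unique a b {w} 1≤ eq with <-cmp a b
... | tri≈ _ a≡b _ = a≡b
... | tri< a<b _ _ = ⊥-elim (<-irrefl (sym eq) (parentIter-shrinks w a<b 1≤))
... | tri> _ _ b<a = ⊥-elim (<-irrefl eq (parentIter-shrinks w b<a (subst (1 ≤_) eq 1≤)))

parentIter-up : ∀ j {w c v} → ⌊ c /2⌋ ≡ v → parentIter j w ≡ c → parentIter (suc j) w ≡ v
parentIter-up j {w} c/2≡v pj = trans (parentIter-suc j w) (trans (cong ⌊_/2⌋ pj) c/2≡v)

Below : ℕ → ℕ → ℕ → Set
Below n v w = ∃[ k ] (1 ≤ k × k ≤ n × parentIter k w ≡ v)

Below⇒IsAncestor : ∀ {n v w} → Below n v w → IsAncestor v w
Below⇒IsAncestor (k , 1≤k , _ , pk) = k , 1≤k , pk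

child-Below : ∀ {n c v} → ⌊ c /2⌋ ≡ v → Below (suc n) v c
child-Below {c = c} c/2≡v = 1 , s≤s z≤n , s≤s z≤n , trans (/2≡⌊/2⌋ c) c/2≡v

Below-lift : ∀ {n c v w} → ⌊ c /2⌋ ≡ v → Below n c w → Below (suc n) v w
Below-lift c/2≡v (k , 1≤k , k≤n , pk) = suc k , s≤s z≤n , s≤s k≤n , parentIter-up k c/2≡v pk

Below-split : ∀ {n v w} → Below (suc n) v w → ∃[ c ] (⌊ c /2⌋ ≡ v × (w ≡ c ⊎ Below n c w))
Below-split {w = w} (suc zero    , _ , _         , p) = w , trans (sym (/2≡⌊/2⌋ w)) p , inj₁ refl
Below-split {w = w} (suc (suc k) , _ , s≤s k<n , p) =
  parentIter (suc k) w , trans (sym (/2≡⌊/2⌋ _)) p , inj₂ (suc k , s≤s z≤n , k<n , refl)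

descend : ∀ {n v c u w} j → 1 ≤ v → ⌊ c /2⌋ ≡ v → parentIter j u ≡ c → IsAncestor u w → Below (suc n) v w → Below n c w
descend {n} {v} {c} {u} {w} j 1≤v c/2≡v pj (k , 1≤k , pk) (m , _ , m≤1+n , pm) =
  j + k , ≤-trans 1≤k (m≤n+m k j) , ≤-pred (subst (_≤ suc n) (sym 1+j+k≡m) m≤1+n) , reach
  where
  reach : parentIter (j + k) w ≡ c
  reach = trans (parentIter-+ j k w) (trans (cong (parentIter j) pk) pj)
  1+j+k≡m : suc (j + k) ≡ m
  1+j+k≡m = depth-unique (suc (j + k)) m (subst (1 ≤_) (sym up) 1≤v) (trans up (sym pm))
    where up = parentIter-up (j + k) c/2≡v reach

siblings-disjoint : ∀ {n n′ v c c′ w} → 1 ≤ v → ⌊ c /2⌋ ≡ v → ⌊ c′ /2⌋ ≡ v → Below n c w → Below n′ c′ w → c ≡ c′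
siblings-disjoint {v = v} {w = w} 1≤v c/2≡v c′/2≡v (k , _ , _ , pk) (k′ , _ , _ , pk′) =
  trans (sym pk) (trans (cong (λ j → parentIter j w) (suc-injective k+1≡k′+1)) pk′)
  where
  up = parentIter-up k c/2≡v pk
  k+1≡k′+1 = depth-unique (suc k) (suc k′) (subst (1 ≤_) (sym up) 1≤v) (trans up (sym (parentIter-up k′ c′/2≡v pk′)))

Below-≢-sibling : ∀ {n v c c′ w} → 1 ≤ v → ⌊ c /2⌋ ≡ v → ⌊ c′ /2⌋ ≡ v → Below n c w → w ≢ c′
Below-≢-sibling {v = v} {c′ = c′} 1≤v c/2≡v c′/2≡v (k , 1≤k , _ , pk) refl =
  <-irrefl (sym (suc-injective k+1≡1)) 1≤k
  where
  up = parentIter-up k c/2≡v pk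
  k+1≡1 = depth-unique (suc k) 1 (subst (1 ≤_) (sym up) 1≤v) (trans up (sym (parentIter-up 0 c′/2≡v refl)))

treeAt : (ℕ → ℕ) → ℕ → (n : ℕ) → Tree n
treeAt col v zero    = leaf
treeAt col v (suc n) = fork (col (2 * v)) (col (suc (2 * v))) (treeAt col (2 * v) n) (treeAt col (suc (2 * v)) n)

left-child : ∀ v → ⌊ 2 * v /2⌋ ≡ v
left-child = ⌊2*v/2⌋≡v

right-child : ∀ v → ⌊ suc (2 * v) /2⌋ ≡ v
right-child = ⌊1+2*v/2⌋≡v

Below-zero : ∀ {v w} → ¬ Below 0 v w
Below-zero (k , 1≤k , k≤0 , _) = <⇒≱ 1≤k k≤0

1≤child : ∀ {c v} → 1 ≤ v → ⌊ c /2⌋ ≡ v → 1 ≤ c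
1≤child {zero}  1≤v refl = 1≤v
1≤child {suc c} _   _    = s≤s z≤n

module _ {col : ℕ → ℕ} where

  child-of-treeAt : ∀ {n v c} (P : ℕ → Tree n → Set) → ⌊ c /2⌋ ≡ v →
                    P (2 * v) (treeAt col (2 * v) n) → P (suc (2 * v)) (treeAt col (suc (2 * v)) n) → P c (treeAt col c n)
  child-of-treeAt {v = v} P c/2≡v left right with ⌊w/2⌋≡v⇒ c/2≡v
  ... | inj₁ refl = left
  ... | inj₂ refl = right

  treeAt-cong : ∀ {g} n {v} → (∀ {w} → Below n v w → col w ≡ g w) → treeAt col v n ≡ treeAt g v n
  treeAt-cong zero    _    = refl
  treeAt-cong (suc n) {v} agree =
    cong₂ (λ (x , y) (l , r) → fork x y l r)
          (cong₂ _,_ (agree (child-Below (left-child v))) (agree (child-Below (right-child v))))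
          (cong₂ _,_ (treeAt-cong n (agree ∘ Below-lift (left-child v))) (treeAt-cong n (agree ∘ Below-lift (right-child v))))

  AllNodes-treeAt⁺ : ∀ {P : ℕ → Set} n {v} → (∀ {w} → Below n v w → P (col w)) → AllNodes P (treeAt col v n)
  AllNodes-treeAt⁺ zero    _   = tt
  AllNodes-treeAt⁺ (suc n) {v} all =
    all (child-Below (left-child v)) , all (child-Below (right-child v)) ,
    AllNodes-treeAt⁺ n (all ∘ Below-lift (left-child v)) , AllNodes-treeAt⁺ n (all ∘ Below-lift (right-child v))

  AllNodes-child : ∀ {P : ℕ → Set} {n v c} → ⌊ c /2⌋ ≡ v → AllNodes P (treeAt col v (suc n)) → P (col c) × AllNodes P (treeAt col c n)
  AllNodes-child {P} c/2≡v (pl , pr , all-l , all-r) = child-of-treeAt (λ c t → P (col c) × AllNodes P t) c/2≡v (pl , all-l) (pr , all-r)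

  AllNodes-treeAt⁻ : ∀ {P : ℕ → Set} n {v w} → AllNodes P (treeAt col v n) → Below n v w → P (col w)
  AllNodes-treeAt⁻ zero    _   below = ⊥-elim (Below-zero below)
  AllNodes-treeAt⁻ (suc n) all below with Below-split below
  ... | c , c/2≡v , inj₁ refl   = proj₁ (AllNodes-child c/2≡v all)
  ... | c , c/2≡v , inj₂ below′ = AllNodes-treeAt⁻ n (proj₂ (AllNodes-child c/2≡v all)) below′

  record AncestralAt (As : List ℕ) (n v : ℕ) : Set where
    field
      fresh    : ∀ {w} → Below n v w → col w ∉ As
      distinct : ∀ {u w} → Below n v u → Below n v w → IsAncestor u w → col u ≢ col w

  AncestralAt-child : ∀ {As n v c} → ⌊ c /2⌋ ≡ v → AncestralAt As (suc n) v → AncestralAt (col c ∷ As) n c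
  AncestralAt-child c/2≡v anc = record
    { fresh    = λ below → λ { (here eq) → distinct (child-Below c/2≡v) (Below-lift c/2≡v below) (Below⇒IsAncestor below) (sym eq)
                             ; (there w∈As) → fresh (Below-lift c/2≡v below) w∈As }
    ; distinct = λ below-u below-w → distinct (Below-lift c/2≡v below-u) (Below-lift c/2≡v below-w)
    }
    where open AncestralAt anc

  ancestral⁺ : ∀ {As} n {v} → AncestralAt As n v → Ancestral As (treeAt col v n)
  ancestral⁺ zero    _       = tt
  ancestral⁺ (suc n) {v} anc =
    AncestralAt.fresh anc (child-Below (left-child v)) , AncestralAt.fresh anc (child-Below (right-child v)) ,
    ancestral⁺ n (AncestralAt-child (left-child v) anc) , ancestral⁺ n (AncestralAt-child (right-child v) anc)

  Ancestral-child : ∀ {As n v c} → ⌊ c /2⌋ ≡ v → Ancestral As (treeAt col v (suc n)) → col c ∉ As × Ancestral (col c ∷ As) (treeAt col c n)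
  Ancestral-child {As} c/2≡v (l∉ , r∉ , anc-l , anc-r) =
    child-of-treeAt (λ c t → col c ∉ As × Ancestral (col c ∷ As) t) c/2≡v (l∉ , anc-l) (r∉ , anc-r)

  ancestral⁻ : ∀ {As} n {v} → 1 ≤ v → Ancestral As (treeAt col v n) → AncestralAt As n v
  ancestral⁻ zero    _   _   = record { fresh = ⊥-elim ∘ Below-zero ; distinct = λ below → ⊥-elim (Below-zero below) }
  ancestral⁻ {As} (suc n) {v} 1≤v anc = record { fresh = fresh ; distinct = distinct }
    where
    below-child : ∀ {c} → ⌊ c /2⌋ ≡ v → AncestralAt (col c ∷ As) n c
    below-child c/2≡v = ancestral⁻ n (1≤child 1≤v c/2≡v) (proj₂ (Ancestral-child c/2≡v anc))
    fresh : ∀ {w} → Below (suc n) v w → col w ∉ As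
    fresh below with Below-split below
    ... | c , c/2≡v , inj₁ refl   = proj₁ (Ancestral-child c/2≡v anc)
    ... | c , c/2≡v , inj₂ below′ = AncestralAt.fresh (below-child c/2≡v) below′ ∘ there
    distinct : ∀ {u w} → Below (suc n) v u → Below (suc n) v w → IsAncestor u w → col u ≢ col w
    distinct below-u below-w u-anc-w with Below-split below-u
    ... | c , c/2≡v , inj₁ refl = λ eq →
      AncestralAt.fresh (below-child c/2≡v) (descend 0 1≤v c/2≡v refl u-anc-w below-w) (here (sym eq))
    ... | c , c/2≡v , inj₂ below-u′@(j , _ , _ , pj) =
      AncestralAt.distinct (below-child c/2≡v) below-u′ (descend j 1≤v c/2≡v pj u-anc-w below-w) u-anc-w

countRange : (ℕ → ℕ) → ℕ → ℕ → ℕ → ℕ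
countRange col i a m = length (filter (λ w → col w ≟ i) (rangeFrom a m))

countRange-suc : ∀ col i a m → countRange col i a (suc m) ≡ δ i (col a) + countRange col i (suc a) m
countRange-suc col i a m with col a ≟ i
... | yes refl = trans (cong length (List.filter-accept (λ w → col w ≟ i) refl)) (cong (_+ countRange col i (suc a) m) (sym (δ-refl i)))
... | no  ≢i   = trans (cong length (List.filter-reject (λ w → col w ≟ i) ≢i)) (cong (_+ countRange col i (suc a) m) (sym (δ-≢ (≢i ∘ sym))))

countRange-+ : ∀ col i a m m′ → countRange col i a (m + m′) ≡ countRange col i a m + countRange col i (a + m) m′
countRange-+ col i a m m′ = trans (cong (length ∘ filter (λ w → col w ≟ i)) (rangeFrom-+ a m m′))
  (trans (cong length (List.filter-++ (λ w → col w ≟ i) (rangeFrom a m) _)) (List.length-++ (filter (λ w → col w ≟ i) (rangeFrom a m))))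

-- The nodes k levels below v are 2^k v, …, 2^k v + 2^k − 1.
layer : (ℕ → ℕ) → ℕ → ℕ → ℕ → ℕ
layer col i v k = countRange col i (2 ^ k * v) (2 ^ k)

layer-suc : ∀ col i v k → layer col i v (suc k) ≡ layer col i (2 * v) k + layer col i (suc (2 * v)) k
layer-suc col i v k = begin
  countRange col i (2 * p * v) (2 * p)                                     ≡⟨ cong (countRange col i (2 * p * v)) (sym (x+x≡2*x p)) ⟩
  countRange col i (2 * p * v) (p + p)                                     ≡⟨ countRange-+ col i (2 * p * v) p p ⟩
  countRange col i (2 * p * v) p + countRange col i (2 * p * v + p) p
    ≡⟨ cong₂ (λ a b → countRange col i a p + countRange col i b p) (left p v) (right p v) ⟩
  countRange col i (p * (2 * v)) p + countRange col i (p * suc (2 * v)) p  ∎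
  where
  open ≡-Reasoning
  p = 2 ^ k
  left : ∀ p v → 2 * p * v ≡ p * (2 * v)
  left = solve-∀
  right : ∀ p v → 2 * p * v + p ≡ p * suc (2 * v)
  right = solve-∀

count-treeAt : ∀ col i n v → count i (treeAt col v n) ≡ sumTo n (layer col i v)
count-treeAt col i zero    v = refl
count-treeAt col i (suc n) v = begin
  δ i (col (2 * v)) + δ i (col (suc (2 * v))) + count i (treeAt col (2 * v) n) + count i (treeAt col (suc (2 * v)) n)
    ≡⟨ cong₂ (λ x y → δ i (col (2 * v)) + δ i (col (suc (2 * v))) + x + y) (count-treeAt col i n (2 * v)) (count-treeAt col i n (suc (2 * v))) ⟩
  δ i (col (2 * v)) + δ i (col (suc (2 * v))) + sumTo n (layer col i (2 * v)) + sumTo n (layer col i (suc (2 * v)))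
    ≡⟨ +-assoc (δ i (col (2 * v)) + δ i (col (suc (2 * v)))) _ _ ⟩
  δ i (col (2 * v)) + δ i (col (suc (2 * v))) + (sumTo n (layer col i (2 * v)) + sumTo n (layer col i (suc (2 * v))))
    ≡⟨ cong₂ _+_ (sym first-layer) (sym (sumTo-+ n _ _)) ⟩
  layer col i v 1 + sumTo n (λ k → layer col i (2 * v) k + layer col i (suc (2 * v)) k)
    ≡⟨ cong (layer col i v 1 +_) (sumTo-cong n (λ k _ _ → sym (layer-suc col i v k))) ⟩
  layer col i v 1 + sumTo n (layer col i v ∘ suc)
    ≡⟨ sym (sumTo-front n (layer col i v)) ⟩
  sumTo (suc n) (layer col i v) ∎
  where
  open ≡-Reasoning
  first-layer : layer col i v 1 ≡ δ i (col (2 * v)) + δ i (col (suc (2 * v)))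
  first-layer = trans (countRange-suc col i (2 * v) 1) (cong (δ i (col (2 * v)) +_) (trans (countRange-suc col i (suc (2 * v)) 0) (+-identityʳ _)))

colorCount-layers : ∀ h col i → colorCount h col i ≡ sumTo h (layer col i 1)
colorCount-layers zero    col i = refl
colorCount-layers (suc h) col i = begin
  countRange col i 2 (2 ^ suc (suc h) ∸ 2)                                         ≡⟨ cong (countRange col i 2) split ⟩
  countRange col i 2 ((2 ^ suc h ∸ 2) + 2 ^ suc h)                                 ≡⟨ countRange-+ col i 2 (2 ^ suc h ∸ 2) (2 ^ suc h) ⟩
  countRange col i 2 (2 ^ suc h ∸ 2) + countRange col i (2 + (2 ^ suc h ∸ 2)) (2 ^ suc h)
    ≡⟨ cong₂ _+_ (colorCount-layers h col i) (cong (λ a → countRange col i a (2 ^ suc h)) start) ⟩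
  sumTo h (layer col i 1) + layer col i 1 (suc h)                                  ∎
  where
  open ≡-Reasoning
  2≤ : 2 ≤ 2 ^ suc h
  2≤ = *-monoʳ-≤ 2 (m^n>0 2 h)
  split : 2 ^ suc (suc h) ∸ 2 ≡ (2 ^ suc h ∸ 2) + 2 ^ suc h
  split = trans (cong (_∸ 2) (sym (x+x≡2*x (2 ^ suc h)))) (+-∸-comm (2 ^ suc h) 2≤)
  start : 2 + (2 ^ suc h ∸ 2) ≡ 2 ^ suc h * 1
  start = trans (m+[n∸m]≡n 2≤) (sym (*-identityʳ _))

-- paint t v w is the colour of node w when the root of t sits at node v, and 0 if w is not below v;
-- the subtrees of the two children are disjoint, so the sum selects the right one.
paint : ∀ {n} → Tree n → ℕ → ℕ → ℕ
paint leaf           v w = 0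
paint (fork a b l r) v w with w ≟ 2 * v | w ≟ suc (2 * v)
... | yes _ | _     = a
... | no  _ | yes _ = b
... | no  _ | no  _ = paint l (2 * v) w + paint r (suc (2 * v)) w

paint-outside : ∀ {n} (t : Tree n) v w → ¬ Below n v w → paint t v w ≡ 0
paint-outside leaf           v w _       = refl
paint-outside (fork a b l r) v w ¬below with w ≟ 2 * v | w ≟ suc (2 * v)
... | yes refl | _        = ⊥-elim (¬below (child-Below (left-child v)))
... | no  _    | yes refl = ⊥-elim (¬below (child-Below (right-child v)))
... | no  _    | no  _    = cong₂ _+_ (paint-outside l (2 * v) w (¬below ∘ Below-lift (left-child v)))
                                      (paint-outside r (suc (2 * v)) w (¬below ∘ Below-lift (right-child v)))

paint-left : ∀ {n a b} {l r : Tree n} {v w} → 1 ≤ v → Below n (2 * v) w → paint (fork a b l r) v w ≡ paint l (2 * v) w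
paint-left {l = l} {r} {v} {w} 1≤v below with w ≟ 2 * v | w ≟ suc (2 * v)
... | yes w≡ | _        = ⊥-elim (Below-≢-sibling 1≤v (left-child v) (left-child v) below w≡)
... | no  _  | yes w≡   = ⊥-elim (Below-≢-sibling 1≤v (left-child v) (right-child v) below w≡)
... | no  _  | no  _    = trans (cong (paint l (2 * v) w +_) (paint-outside r (suc (2 * v)) w
                                  (2*v≢1+2*v v ∘ siblings-disjoint 1≤v (left-child v) (right-child v) below))) (+-identityʳ _)

paint-right : ∀ {n a b} {l r : Tree n} {v w} → 1 ≤ v → Below n (suc (2 * v)) w → paint (fork a b l r) v w ≡ paint r (suc (2 * v)) w
paint-right {l = l} {r} {v} {w} 1≤v below with w ≟ 2 * v | w ≟ suc (2 * v)
... | yes w≡ | _        = ⊥-elim (Below-≢-sibling 1≤v (right-child v) (left-child v) below w≡)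
... | no  _  | yes w≡   = ⊥-elim (Below-≢-sibling 1≤v (right-child v) (right-child v) below w≡)
... | no  _  | no  _    = cong (_+ paint r (suc (2 * v)) w) (paint-outside l (2 * v) w
                                  (2*v≢1+2*v v ∘ sym ∘ siblings-disjoint 1≤v (right-child v) (left-child v) below))

treeAt-paint : ∀ {n} (t : Tree n) v → 1 ≤ v → treeAt (paint t v) v n ≡ t
treeAt-paint leaf           v _   = refl
treeAt-paint {suc n} (fork a b l r) v 1≤v =
  cong₂ (λ (x , y) (l′ , r′) → fork x y l′ r′) (cong₂ _,_ at-left at-right)
        (cong₂ _,_ (trans (treeAt-cong n (paint-left 1≤v)) (treeAt-paint l (2 * v) (≤-trans 1≤v (m≤m+n v _))))
                   (trans (treeAt-cong n (paint-right 1≤v)) (treeAt-paint r (suc (2 * v)) (s≤s z≤n))))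
  where
  at-left : paint (fork a b l r) v (2 * v) ≡ a
  at-left with 2 * v ≟ 2 * v
  ... | yes _   = refl
  ... | no  2v≢ = ⊥-elim (2v≢ refl)
  at-right : paint (fork a b l r) v (suc (2 * v)) ≡ b
  at-right with suc (2 * v) ≟ 2 * v | suc (2 * v) ≟ suc (2 * v)
  ... | yes eq | _     = ⊥-elim (2*v≢1+2*v v (sym eq))
  ... | no  _  | yes _ = refl
  ... | no  _  | no ≢  = ⊥-elim (≢ refl)

parentIter-bound : ∀ k {x} w → parentIter k w ≤ x → w < 2 ^ k * suc x
parentIter-bound zero    {x} w w≤x = s≤s (≤-trans w≤x (≤-reflexive (sym (+-identityʳ x))))
parentIter-bound (suc k) {x} w ≤x  = <-≤-trans (parentIter-bound k w (⌊y/2⌋≤x⇒y≤1+2x _ (subst (_≤ x) (parentIter-suc k w) ≤x)))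
                                               (≤-reflexive (regroup (2 ^ k) x))
  where
  regroup : ∀ p x → p * suc (suc (2 * x)) ≡ 2 * p * suc x
  regroup = solve-∀

ancestor-1⇒2≤ : ∀ k w → 1 ≤ k → parentIter k w ≡ 1 → 2 ≤ w
ancestor-1⇒2≤ k zero    _   pk = ⊥-elim (1+n≰n (subst (_≤ 0) pk (parentIter-≤ k 0)))
ancestor-1⇒2≤ k (suc w) 1≤k pk = subst (_< suc w) pk (parentIter-< k 1≤k (s≤s z≤n))

Below⇒IsNonRootNode : ∀ {h w} → Below h 1 w → IsNonRootNode h w
Below⇒IsNonRootNode {h} {w} (k , 1≤k , k≤h , pk) = ancestor-1⇒2≤ k w 1≤k pk , (begin-strict
  w              <⟨ parentIter-bound k w (≤-reflexive pk) ⟩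
  2 ^ k * 2      ≡⟨ *-comm (2 ^ k) 2 ⟩
  2 ^ suc k      ≤⟨ ^-monoʳ-≤ 2 (s≤s k≤h) ⟩
  2 ^ suc h      ∎)
  where open ≤-Reasoning

IsNonRootNode⇒Below : ∀ h {w} → IsNonRootNode h w → Below h 1 w
IsNonRootNode⇒Below zero        (2≤w , w<2) = ⊥-elim (<⇒≱ w<2 2≤w)
IsNonRootNode⇒Below (suc h) {w} (2≤w , w<) with w <? 4
... | yes w<4 = 1 , s≤s z≤n , s≤s z≤n , trans (/2≡⌊/2⌋ w) (≤-antisym (⌊n/2⌋-mono (≤-pred w<4)) (⌊n/2⌋-mono 2≤w))
... | no  w≮4 = suc k , s≤s z≤n , s≤s k≤h , reach
  where
  parent-below = IsNonRootNode⇒Below h (⌊n/2⌋-mono (≮⇒≥ w≮4) , ⌊w/2⌋<m w<)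
  k   = proj₁ parent-below
  k≤h = proj₁ (proj₂ (proj₂ parent-below))
  reach : parentIter (suc k) w ≡ 1
  reach = trans (cong (λ j → parentIter j w) (+-comm 1 k))
                (trans (parentIter-+ k 1 w) (trans (cong (parentIter k) (/2≡⌊/2⌋ w)) (proj₂ (proj₂ (proj₂ parent-below)))))

theorem2 : (h : ℕ) → 1 ≤ h → (c : ℕ → ℕ) → IsColorSequence h c →
    HasAncestralColoring h c ⇔ IsFeasible h c
theorem2 h _ c seq = mk⇔ necessary sufficient
  where
  necessary : HasAncestralColoring h c → IsFeasible h c
  necessary (col , in-range , counts , distinct) = feasible-tree h c (treeAt col 1 h)
    (ancestral⁺ h (record { fresh = λ _ () ; distinct = λ u∈ w∈ → distinct _ _ (Below⇒IsNonRootNode u∈) (Below⇒IsNonRootNode w∈) }))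
    (AllNodes-treeAt⁺ h (in-range _ ∘ Below⇒IsNonRootNode))
    (λ i 1≤i i≤h → trans (count-treeAt col i h 1) (trans (sym (colorCount-layers h col i)) (counts i 1≤i i≤h)))

  sufficient : IsFeasible h c → HasAncestralColoring h c
  sufficient feasible with realise-palette h c seq feasible
  ... | t , ancestral , in-range , counts =
    col ,
    (λ v v∈T → AllNodes-treeAt⁻ h (subst (AllNodes (InRange h)) (sym t≡) in-range) (IsNonRootNode⇒Below h v∈T)) ,
    (λ i 1≤i i≤h → trans (colorCount-layers h col i) (trans (sym (count-treeAt col i h 1)) (trans (cong (count i) t≡) (counts i 1≤i i≤h)))) ,
    (λ u v u∈T v∈T → AncestralAt.distinct (ancestral⁻ h (s≤s z≤n) (subst (Ancestral []) (sym t≡) ancestral))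
                                          (IsNonRootNode⇒Below h u∈T) (IsNonRootNode⇒Below h v∈T))
    where
    col = paint t 1
    t≡ : treeAt col 1 h ≡ t
    t≡ = treeAt-paint t 1 (s≤s z≤n)
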